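{- Call a triple of integers $(q,n,\ell)$ with $q\ge 2$, $n\ge 2$, $\ell\ge 1$ \emph{admissible} if either $(q,n)=(2,2)$, or $(n,\ell)=(2,1)$, or $(q,n,\ell)\in\{(2,3,1),(2,3,2),(3,2,2),(3,2,3),(3,3,1),(2,4,1),(4,2,2)\}$; otherwise call it \emph{inadmissible}. (a) Assuming the $abc$ conjecture, there are only finitely many tuples $(q,n,\ell,b,y,c)$ of integers with $q,n\ge 2$, $\ell\ge 1$, $b\ge 2$, $y\ge 1$, $b^{\ell-1}\le c<b^\ell$, $(q,n,\ell)$ inadmissible, and $$y^q = c\,\frac{b^{n\ell}-1}{b^\ell-1}.$$ (b) For each admissible triple $(q,n,\ell)$, there are infinitely many pairs $(b,y)$ of integers with $b\ge 2$, $y\ge 1$ for which there exists a word $w$ over $\{0,1,\dots,b-1\}$ of length $|w|=\ell$ with $(y^q)_b = w\uparrow n$.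
   Context: For an integer $b\ge 2$ and integer $m\ge 0$, $(m)_b$ denotes the canonical base-$b$ representation of $m$ (the word over the digit alphabet $\{0,1,\dots,b-1\}$ with no leading zeros). For a word $w$, $|w|$ is its length and $w\uparrow n$ denotes the concatenation of $n$ copies of $w$. The $abc$ conjecture (Masser–Oesterlé) states: for every $\epsilon>0$ there is a constant $C_\epsilon$ such that for all positive integers $a,b,c$ with $a+b=c$ and $\gcd(a,b)=1$, $c\le C_\epsilon\,\mathrm{rad}(abc)^{1+\epsilon}$, where $\mathrm{rad}(m)$ is the product of the distinct primes dividing $m$. -}

module Defs where

open import Data.Nat using (ℕ; zero; suc; _+_; _*_; _∸_; _^_; _≤_; _<_)
open import Data.Nat.DivMod using (_/_; _%_)
open import Data.Nat.Divisibility using (_∣?_)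
open import Data.Nat.Primality using (prime?)
open import Data.Nat.Coprimality using (Coprime)
open import Data.List using (List; []; _∷_; _++_; [_]; filter; upTo; concat; replicate)
open import Data.Nat.ListAction using (product)
open import Data.Product using (_×_; ∃-syntax; _,_)
open import Data.Sum using (_⊎_)
open import Relation.Binary.PropositionalEquality using (_≡_)
open import Relation.Nullary.Decidable using (_×-dec_)

rad : ℕ → ℕ
rad m = product (filter (λ p → prime? p ×-dec (p ∣? m)) (upTo (suc m)))

-- The abc conjecture.  For ε = num/den > 0 (num, den ≥ 1) there is C with
-- c ≤ C · rad(abc)^(1+ε), written without real exponents as
-- c^den ≤ C^den · rad(abc)^(den+num).
ABC : Set
ABC = (num den : ℕ) → 1 ≤ num → 1 ≤ den →
      ∃[ C ] ((a b c : ℕ) → 1 ≤ a → 1 ≤ b → a + b ≡ c → Coprime a b →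
              c ^ den ≤ C ^ den * rad (a * b * c) ^ (den + num))

-- Canonical base-b representation (most significant digit first, no
-- leading zeros; (0)_b is the empty word).  Only meaningful for b ≥ 2.
-- The fuel argument m suffices since m / b < m for m ≥ 1, b ≥ 2.
digitsAux : (k fuel m : ℕ) → List ℕ
digitsAux k zero m = []
digitsAux k (suc f) zero = []
digitsAux k (suc f) (suc m) = digitsAux k f (suc m / suc k) ++ [ suc m % suc k ]

rep : (b m : ℕ) → List ℕ
rep zero m = []
rep (suc k) m = digitsAux k m m

_↑_ : List ℕ → ℕ → List ℕ
w ↑ n = concat (replicate n w)

Admissible : ℕ → ℕ → ℕ → Set
Admissible q n ℓ =
    (q ≡ 2 × n ≡ 2)
  ⊎ (n ≡ 2 × ℓ ≡ 1)
  ⊎ (q ≡ 2 × n ≡ 3 × ℓ ≡ 1)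
  ⊎ (q ≡ 2 × n ≡ 3 × ℓ ≡ 2)
  ⊎ (q ≡ 3 × n ≡ 2 × ℓ ≡ 2)
  ⊎ (q ≡ 3 × n ≡ 2 × ℓ ≡ 3)
  ⊎ (q ≡ 3 × n ≡ 3 × ℓ ≡ 1)
  ⊎ (q ≡ 2 × n ≡ 4 × ℓ ≡ 1)
  ⊎ (q ≡ 4 × n ≡ 2 × ℓ ≡ 2)

Tuple : Set
Tuple = ℕ × ℕ × ℕ × ℕ × ℕ × ℕ

{-# OPTIONS --safe #-}
-- (a) Put B = bˡ. The equation reads yᵠ = c (Bⁿ − 1)/(B − 1), so every prime factor of the abc triple
-- (B − 1) · (Bⁿ − 1)/(B − 1) + 1 = Bⁿ divides r = y (B − 1) b. From yᵠ < Bⁿ and bˡ = B we get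
-- r^(qℓ) ≤ B^(nℓ + qℓ + q), and for an inadmissible triple nℓ + qℓ + q ≤ (23/24) nqℓ; so the radical is
-- at most (Bⁿ)^(23/24), and the abc conjecture with ε = 1/47 bounds Bⁿ, which dominates every coordinate.
-- (b) The triples (2 , 2 , ℓ) and (q , 2 , 1) have polynomial families of solutions; each of the seven
-- sporadic triples has solutions along the orbit of a Pell unit acting on a conic b² ± b + 1 = dt² or b² + 1 = dv².
module Submission where

open import Defs
open import Data.Nat
  using (ℕ; zero; suc; _+_; _*_; _∸_; _^_; _≤_; _<_; z≤n; s≤s; s≤s⁻¹; NonZero; >-nonZero; nonTrivial⇒≢1)
open import Data.Nat.Properties
open import Data.Nat.Divisibility using (_∣_; _∤_; divides; 1∣_; ∣1⇒≡1; ∣⇒≤; _∣?_; ∣-trans; m∣m*n; n∣m*n)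
open import Data.Nat.DivMod
  using (_/_; _%_; m<n⇒m/n≡0; m<n⇒m%n≡m; m*n/n≡m; +-distrib-/-∣ˡ; [m+kn]%n≡m%n; m%n<n; m≡m%n+[m/n]*n; m<n*o⇒m/o<n)
open import Data.Nat.Primality using (Prime; prime?; euclidsLemma; prime⇒irreducible; prime⇒nonTrivial)
open import Data.Nat.Coprimality using (Coprime; coprime-divisor; 1-coprimeTo)
import Data.Nat.Coprimality as Coprime
open import Data.Nat.ListAction using (product)
open import Data.Nat.Tactic.RingSolver using (solve-∀)
open import Data.List using (List; []; _∷_; _++_; [_]; foldl; length; filter; upTo; cartesianProduct)
open import Data.List.Properties using (foldl-++; length-++)
open import Data.List.Reverse using (Reverse; []; _∶_∶ʳ_; reverseView)
open import Data.List.Membership.Propositional using (_∈_)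
open import Data.List.Membership.Propositional.Properties using (∈-cartesianProduct⁺; ∈-upTo⁺)
open import Data.List.Relation.Unary.All as All using (All; []; _∷_)
open import Data.List.Relation.Unary.All.Properties using (all-filter; ++⁺; ∷ʳ⁻; concat⁺; replicate⁺)
open import Data.List.Relation.Unary.AllPairs using ([]; _∷_)
open import Data.List.Relation.Unary.Unique.Propositional using (Unique)
import Data.List.Relation.Unary.Unique.Propositional.Properties as Unique
open import Data.Product using (_×_; _,_; proj₁; proj₂; ∃-syntax)
open import Data.Sum using (_⊎_; inj₁; inj₂)
open import Data.Empty using (⊥-elim)
open import Function using (_∘_)
open import Relation.Nullary using (¬_; contradiction)
open import Relation.Nullary.Decidable using (_×-dec_)
open import Relation.Unary using (Decidable)
open import Relation.Binary.PropositionalEquality hiding ([_])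

-- Radicals

prime≢1 : ∀ {p} → Prime p → p ≢ 1
prime≢1 pp = nonTrivial⇒≢1 {{prime⇒nonTrivial pp}}

prime∤1 : ∀ {p} → Prime p → p ∤ 1
prime∤1 pp = prime≢1 pp ∘ ∣1⇒≡1

prime∤product : ∀ {p} xs → Prime p → All Prime xs → All (p ≢_) xs → p ∤ product xs
prime∤product [] pp _ _ = prime∤1 pp
prime∤product (x ∷ xs) pp (px ∷ pxs) (p≢x ∷ p≢xs) p∣x*xs with euclidsLemma x (product xs) pp p∣x*xs
... | inj₂ p∣xs = prime∤product xs pp pxs p≢xs p∣xs
... | inj₁ p∣x with prime⇒irreducible px p∣x
...   | inj₁ p≡1 = prime≢1 pp p≡1
...   | inj₂ p≡x = p≢x p≡x

prime∤⇒coprime : ∀ {p m} → Prime p → p ∤ m → Coprime p m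
prime∤⇒coprime pp p∤m (d∣p , d∣m) with prime⇒irreducible pp d∣p
... | inj₁ d≡1 = d≡1
... | inj₂ refl = ⊥-elim (p∤m d∣m)

prime∣^⇒∣ : ∀ {p} m k → Prime p → p ∣ m ^ k → p ∣ m
prime∣^⇒∣ m zero pp p∣1 = ⊥-elim (prime∤1 pp p∣1)
prime∣^⇒∣ m (suc k) pp p∣m*mᵏ with euclidsLemma m (m ^ k) pp p∣m*mᵏ
... | inj₁ p∣m = p∣m
... | inj₂ p∣mᵏ = prime∣^⇒∣ m k pp p∣mᵏ

product-distinctPrimes∣ : ∀ {r} xs → Unique xs → All Prime xs → All (_∣ r) xs → product xs ∣ r
product-distinctPrimes∣ [] _ _ _ = 1∣ _
product-distinctPrimes∣ {r} (x ∷ xs) (x∉xs ∷ u) (px ∷ pxs) (x∣r ∷ xs∣r)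
  with product-distinctPrimes∣ xs u pxs xs∣r
... | divides k r≡k*xs with coprime-divisor (prime∤⇒coprime px (prime∤product xs px pxs x∉xs))
                              (subst (x ∣_) (trans r≡k*xs (*-comm k (product xs))) x∣r)
...   | divides j k≡j*x = divides j (begin
          r                  ≡⟨ r≡k*xs ⟩
          k * product xs     ≡⟨ cong (_* product xs) k≡j*x ⟩
          j * x * product xs ≡⟨ *-assoc j x (product xs) ⟩
          j * (x * product xs) ∎)
  where open ≡-Reasoning

rad≤ : ∀ m r → 1 ≤ r → (∀ p → Prime p → p ∣ m → p ∣ r) → rad m ≤ r
rad≤ m r r≥1 primes∣r = ∣⇒≤ {{>-nonZero r≥1}}
  (product-distinctPrimes∣ _ (Unique.filter⁺ P? (Unique.upTo⁺ (suc m)))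
    (All.map proj₁ selected) (All.map (λ (pp , p∣m) → primes∣r _ pp p∣m) selected))
  where
  P? : Decidable (λ p → Prime p × p ∣ m)
  P? p = prime? p ×-dec (p ∣? m)
  selected : All (λ p → Prime p × p ∣ m) (filter P? (upTo (suc m)))
  selected = all-filter P? (upTo (suc m))

-- The exponent gap of inadmissible triples

+-witness⇒≤ : ∀ {m n k} → m + k ≡ n → m ≤ n
+-witness⇒≤ {m} {k = k} refl = m≤m+n m k

from-≥ : (P : ℕ → Set) {m n : ℕ} → m ≤ n → (∀ k → P (m + k)) → P n
from-≥ P m≤n P[m+_] = let k , m+k≡n = m≤n⇒∃[o]m+o≡n m≤n in subst P m+k≡n (P[m+_] k)

-- Dividing by nqℓ: 1/q + 1/n + 1/(nℓ) ≤ 23/24.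
ExponentGap : ℕ → ℕ → ℕ → Set
ExponentGap q n ℓ = 24 * (n * ℓ + q * ℓ + q) ≤ 23 * (n * (q * ℓ))

exponentGap-3-2 : ∀ {ℓ} → 4 ≤ ℓ → ExponentGap 3 2 ℓ
exponentGap-3-2 ℓ≥4 =
  from-≥ (ExponentGap 3 2) ℓ≥4 λ ℓ →
  +-witness⇒≤ (gap ℓ)
  where gap : ∀ ℓ → 24 * (2 * (4 + ℓ) + 3 * (4 + ℓ) + 3) + 18 * ℓ
              ≡ 23 * (2 * (3 * (4 + ℓ)))
        gap = solve-∀

exponentGap-4-2 : ∀ {ℓ} → 3 ≤ ℓ → ExponentGap 4 2 ℓ
exponentGap-4-2 ℓ≥3 =
  from-≥ (ExponentGap 4 2) ℓ≥3 λ ℓ →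
  +-witness⇒≤ (gap ℓ)
  where gap : ∀ ℓ → 24 * (2 * (3 + ℓ) + 4 * (3 + ℓ) + 4) + (24 + 40 * ℓ)
              ≡ 23 * (2 * (4 * (3 + ℓ)))
        gap = solve-∀

exponentGap-q-2 : ∀ {q ℓ} → 5 ≤ q → 2 ≤ ℓ → ExponentGap q 2 ℓ
exponentGap-q-2 {q} {ℓ} q≥5 ℓ≥2 =
  from-≥ (λ q → ExponentGap q 2 ℓ) q≥5 λ q →
  from-≥ (ExponentGap (5 + q) 2) ℓ≥2 λ ℓ →
  +-witness⇒≤ (gap q ℓ)
  where gap : ∀ q ℓ → 24 * (2 * (2 + ℓ) + (5 + q) * (2 + ℓ) + (5 + q)) + (4 + 62 * ℓ + 20 * q + 22 * q * ℓ)
              ≡ 23 * (2 * ((5 + q) * (2 + ℓ)))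
        gap = solve-∀

exponentGap-2-3 : ∀ {ℓ} → 3 ≤ ℓ → ExponentGap 2 3 ℓ
exponentGap-2-3 ℓ≥3 =
  from-≥ (ExponentGap 2 3) ℓ≥3 λ ℓ →
  +-witness⇒≤ (gap ℓ)
  where gap : ∀ ℓ → 24 * (3 * (3 + ℓ) + 2 * (3 + ℓ) + 2) + (6 + 18 * ℓ)
              ≡ 23 * (3 * (2 * (3 + ℓ)))
        gap = solve-∀

exponentGap-q-3-1 : ∀ {q} → 4 ≤ q → ExponentGap q 3 1
exponentGap-q-3-1 q≥4 =
  from-≥ (λ q → ExponentGap q 3 1) q≥4 λ q →
  +-witness⇒≤ (gap q)
  where gap : ∀ q → 24 * (3 * 1 + (4 + q) * 1 + (4 + q)) + (12 + 21 * q)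
              ≡ 23 * (3 * ((4 + q) * 1))
        gap = solve-∀

exponentGap-q-3 : ∀ {q ℓ} → 3 ≤ q → 2 ≤ ℓ → ExponentGap q 3 ℓ
exponentGap-q-3 {q} {ℓ} q≥3 ℓ≥2 =
  from-≥ (λ q → ExponentGap q 3 ℓ) q≥3 λ q →
  from-≥ (ExponentGap (3 + q) 3) ℓ≥2 λ ℓ →
  +-witness⇒≤ (gap q ℓ)
  where gap : ∀ q ℓ → 24 * (3 * (2 + ℓ) + (3 + q) * (2 + ℓ) + (3 + q)) + (54 + 63 * ℓ + 66 * q + 45 * q * ℓ)
              ≡ 23 * (3 * ((3 + q) * (2 + ℓ)))
        gap = solve-∀

exponentGap-2-4 : ∀ {ℓ} → 2 ≤ ℓ → ExponentGap 2 4 ℓ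
exponentGap-2-4 ℓ≥2 =
  from-≥ (ExponentGap 2 4) ℓ≥2 λ ℓ →
  +-witness⇒≤ (gap ℓ)
  where gap : ∀ ℓ → 24 * (4 * (2 + ℓ) + 2 * (2 + ℓ) + 2) + (32 + 40 * ℓ)
              ≡ 23 * (4 * (2 * (2 + ℓ)))
        gap = solve-∀

exponentGap-2-n : ∀ {n ℓ} → 5 ≤ n → 1 ≤ ℓ → ExponentGap 2 n ℓ
exponentGap-2-n {n} {ℓ} n≥5 ℓ≥1 =
  from-≥ (λ n → ExponentGap 2 n ℓ) n≥5 λ n →
  from-≥ (ExponentGap 2 (5 + n)) ℓ≥1 λ ℓ →
  +-witness⇒≤ (gap n ℓ)
  where gap : ∀ n ℓ → 24 * ((5 + n) * (1 + ℓ) + 2 * (1 + ℓ) + 2) + (14 + 62 * ℓ + 22 * n + 22 * n * ℓ)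
              ≡ 23 * ((5 + n) * (2 * (1 + ℓ)))
        gap = solve-∀

exponentGap-q-n : ∀ {q n ℓ} → 3 ≤ q → 4 ≤ n → 1 ≤ ℓ → ExponentGap q n ℓ
exponentGap-q-n {q} {n} {ℓ} q≥3 n≥4 ℓ≥1 =
  from-≥ (λ q → ExponentGap q n ℓ) q≥3 λ q →
  from-≥ (λ n → ExponentGap (3 + q) n ℓ) n≥4 λ n →
  from-≥ (ExponentGap (3 + q) (4 + n)) ℓ≥1 λ ℓ →
  +-witness⇒≤ (gap q n ℓ)
  where gap : ∀ q n ℓ → 24 * ((4 + n) * (1 + ℓ) + (3 + q) * (1 + ℓ) + (3 + q))
                        + (36 + 108 * ℓ + 45 * n + 45 * n * ℓ + 44 * q + 68 * q * ℓ + 23 * q * n + 23 * q * n * ℓ)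
              ≡ 23 * ((4 + n) * ((3 + q) * (1 + ℓ)))
        gap = solve-∀

inadmissible⇒exponentGap : ∀ q n ℓ → 2 ≤ q → 2 ≤ n → 1 ≤ ℓ → ¬ Admissible q n ℓ → ExponentGap q n ℓ
inadmissible⇒exponentGap 2 2 _ _ _ _ na = contradiction (inj₁ (refl , refl)) na
inadmissible⇒exponentGap (suc (suc (suc _))) 2 1 _ _ _ na = contradiction (inj₂ (inj₁ (refl , refl))) na
inadmissible⇒exponentGap 3 2 2 _ _ _ na =
  contradiction (inj₂ (inj₂ (inj₂ (inj₂ (inj₁ (refl , refl , refl)))))) na
inadmissible⇒exponentGap 3 2 3 _ _ _ na =
  contradiction (inj₂ (inj₂ (inj₂ (inj₂ (inj₂ (inj₁ (refl , refl , refl))))))) na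
inadmissible⇒exponentGap 3 2 (suc (suc (suc (suc ℓ)))) _ _ _ _ = exponentGap-3-2 (m≤m+n 4 ℓ)
inadmissible⇒exponentGap 4 2 2 _ _ _ na =
  contradiction (inj₂ (inj₂ (inj₂ (inj₂ (inj₂ (inj₂ (inj₂ (inj₂ (refl , refl , refl))))))))) na
inadmissible⇒exponentGap 4 2 (suc (suc (suc ℓ))) _ _ _ _ = exponentGap-4-2 (m≤m+n 3 ℓ)
inadmissible⇒exponentGap (suc (suc (suc (suc (suc q))))) 2 (suc (suc ℓ)) _ _ _ _ =
  exponentGap-q-2 (m≤m+n 5 q) (m≤m+n 2 ℓ)
inadmissible⇒exponentGap 2 3 1 _ _ _ na = contradiction (inj₂ (inj₂ (inj₁ (refl , refl , refl)))) na
inadmissible⇒exponentGap 2 3 2 _ _ _ na = contradiction (inj₂ (inj₂ (inj₂ (inj₁ (refl , refl , refl))))) na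
inadmissible⇒exponentGap 2 3 (suc (suc (suc ℓ))) _ _ _ _ = exponentGap-2-3 (m≤m+n 3 ℓ)
inadmissible⇒exponentGap 3 3 1 _ _ _ na =
  contradiction (inj₂ (inj₂ (inj₂ (inj₂ (inj₂ (inj₂ (inj₁ (refl , refl , refl)))))))) na
inadmissible⇒exponentGap (suc (suc (suc (suc q)))) 3 1 _ _ _ _ = exponentGap-q-3-1 (m≤m+n 4 q)
inadmissible⇒exponentGap (suc (suc (suc q))) 3 (suc (suc ℓ)) _ _ _ _ = exponentGap-q-3 (m≤m+n 3 q) (m≤m+n 2 ℓ)
inadmissible⇒exponentGap 2 4 1 _ _ _ na =
  contradiction (inj₂ (inj₂ (inj₂ (inj₂ (inj₂ (inj₂ (inj₂ (inj₁ (refl , refl , refl))))))))) na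
inadmissible⇒exponentGap 2 4 (suc (suc ℓ)) _ _ _ _ = exponentGap-2-4 (m≤m+n 2 ℓ)
inadmissible⇒exponentGap 2 (suc (suc (suc (suc (suc n))))) (suc ℓ) _ _ _ _ =
  exponentGap-2-n (m≤m+n 5 n) (m≤m+n 1 ℓ)
inadmissible⇒exponentGap (suc (suc (suc q))) (suc (suc (suc (suc n)))) (suc ℓ) _ _ _ _ =
  exponentGap-q-n (m≤m+n 3 q) (m≤m+n 4 n) (m≤m+n 1 ℓ)
inadmissible⇒exponentGap 0 _ _ () _ _ _
inadmissible⇒exponentGap 1 _ _ (s≤s ()) _ _ _
inadmissible⇒exponentGap _ 0 _ _ () _ _
inadmissible⇒exponentGap _ 1 _ _ (s≤s ()) _ _
inadmissible⇒exponentGap _ _ 0 _ _ () _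

-- Powers and repunits

^-distrib-* : ∀ m n o → (m * n) ^ o ≡ m ^ o * n ^ o
^-distrib-* m n zero = refl
^-distrib-* m n (suc o) = trans (cong (m * n *_) (^-distrib-* m n o)) (interchange m n (m ^ o) (n ^ o))
  where interchange : ∀ m n a b → m * n * (a * b) ≡ m * a * (n * b)
        interchange = solve-∀

^-cancelʳ-≤ : ∀ {m n} o → 1 ≤ o → m ^ o ≤ n ^ o → m ≤ n
^-cancelʳ-≤ (suc o) _ mᵒ≤nᵒ = ≮⇒≥ (λ n<m → <⇒≱ (^-monoˡ-< (suc o) n<m) mᵒ≤nᵒ)

m≤m^n : ∀ {m n} → 1 ≤ m → 1 ≤ n → m ≤ m ^ n
m≤m^n {m} {n} 1≤m 1≤n = subst (_≤ m ^ n) (*-identityʳ m) (^-monoʳ-≤ m {{>-nonZero 1≤m}} 1≤n)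

n<2^n : ∀ n → n < 2 ^ n
n<2^n zero = s≤s z≤n
n<2^n (suc n) = +-mono-≤ (m^n>0 2 n) (≤-trans (n<2^n n) (m≤m+n _ 0))

n<m^n : ∀ {m} n → 2 ≤ m → n < m ^ n
n<m^n n 2≤m = <-≤-trans (n<2^n n) (^-monoˡ-≤ n 2≤m)

repunit : ℕ → ℕ → ℕ
repunit B zero = 0
repunit B (suc n) = B ^ n + repunit B n

repunit-geometric : ∀ {B} n → 1 ≤ B → (B ∸ 1) * repunit B n + 1 ≡ B ^ n
repunit-geometric {suc m} zero _ = cong (_+ 1) (*-zeroʳ m)
repunit-geometric {suc m} (suc n) 1≤B = begin
  m * (suc m ^ n + repunit (suc m) n) + 1   ≡⟨ distrib m (suc m ^ n) (repunit (suc m) n) ⟩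
  m * suc m ^ n + (m * repunit (suc m) n + 1) ≡⟨ cong (m * suc m ^ n +_) (repunit-geometric n 1≤B) ⟩
  m * suc m ^ n + suc m ^ n                 ≡⟨ +-comm (m * suc m ^ n) (suc m ^ n) ⟩
  suc m ^ suc n                             ∎
  where open ≡-Reasoning
        distrib : ∀ m x r → m * (x + r) + 1 ≡ m * x + (m * r + 1)
        distrib = solve-∀

2≤repunit : ∀ {B} n → 1 ≤ B → 2 ≤ n → 2 ≤ repunit B n
2≤repunit {B} (suc (suc n)) 1≤B _ =
  +-mono-≤ (m^n>0 B {{>-nonZero 1≤B}} (suc n)) (≤-trans (m^n>0 B {{>-nonZero 1≤B}} n) (m≤m+n _ _))
2≤repunit 1 _ (s≤s ())

repunit-equation : ∀ {x B} c n → 2 ≤ B → x * (B ∸ 1) ≡ c * (B ^ n ∸ 1) → x ≡ c * repunit B n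
repunit-equation {x} {B} c n 2≤B eq = *-cancelʳ-≡ x (c * R) (B ∸ 1) {{>-nonZero (∸-monoˡ-≤ 1 2≤B)}} (begin
  x * (B ∸ 1)               ≡⟨ eq ⟩
  c * (B ^ n ∸ 1)           ≡⟨ cong (λ z → c * (z ∸ 1)) (repunit-geometric n (≤-trans (s≤s z≤n) 2≤B)) ⟨
  c * ((B ∸ 1) * R + 1 ∸ 1) ≡⟨ cong (c *_) (m+n∸n≡m ((B ∸ 1) * R) 1) ⟩
  c * ((B ∸ 1) * R)         ≡⟨ cong (c *_) (*-comm (B ∸ 1) R) ⟩
  c * (R * (B ∸ 1))         ≡⟨ *-assoc c R (B ∸ 1) ⟨
  c * R * (B ∸ 1)           ∎)
  where open ≡-Reasoning
        R = repunit B n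

-- The ring solver does not see through _^_ or repunit, so these are stated on their unfolded normal forms.
repunit-2 : ∀ B → repunit B 2 ≡ B + 1
repunit-2 B = normalForm B
  where normalForm : ∀ B → B * 1 + (1 + 0) ≡ B + 1
        normalForm = solve-∀

repunit-3 : ∀ B → repunit B 3 ≡ B * B + B + 1
repunit-3 B = normalForm B
  where normalForm : ∀ B → B * (B * 1) + (B * 1 + (1 + 0)) ≡ B * B + B + 1
        normalForm = solve-∀

repunit-4 : ∀ B → repunit B 4 ≡ (B + 1) * (B * B + 1)
repunit-4 B = normalForm B
  where normalForm : ∀ B → B * (B * (B * 1)) + (B * (B * 1) + (B * 1 + (1 + 0))) ≡ (B + 1) * (B * B + 1)
        normalForm = solve-∀

^-1 : ∀ x → x ^ 1 ≡ x
^-1 = *-identityʳ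

^-2 : ∀ x → x ^ 2 ≡ x * x
^-2 x = cong (x *_) (*-identityʳ x)

^-3 : ∀ x → x ^ 3 ≡ x * x * x
^-3 x = normalForm x
  where normalForm : ∀ x → x * (x * (x * 1)) ≡ x * x * x
        normalForm = solve-∀

^-4 : ∀ x → x ^ 4 ≡ x * x * (x * x)
^-4 x = normalForm x
  where normalForm : ∀ x → x * (x * (x * (x * 1))) ≡ x * x * (x * x)
        normalForm = solve-∀

-- Finiteness under the abc conjecture

abc-squeeze : ∀ {K P r B} Q S T → 1 ≤ Q → 1 ≤ B → P ^ 47 ≤ K * r ^ 48 → r ^ Q ≤ B ^ S →
              P ^ Q ≡ B ^ T → 24 * S ≤ 23 * T → P ≤ K
abc-squeeze {K} {P} {r} {B} Q S T 1≤Q 1≤B abc r^Q≤B^S P^Q≡B^T gap =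
  ^-cancelʳ-≤ Q 1≤Q (begin
    P ^ Q ≡⟨ P^Q≡B^T ⟩
    B ^ T ≤⟨ *-cancelʳ-≤ (B ^ T) (K ^ Q) (B ^ (46 * T)) {{m^n≢0 B (46 * T)}} squeezed ⟩
    K ^ Q ∎)
  where
  open ≤-Reasoning
  instance
    B≢0 : NonZero B
    B≢0 = >-nonZero 1≤B
  squeezed : B ^ T * B ^ (46 * T) ≤ K ^ Q * B ^ (46 * T)
  squeezed = begin
    B ^ T * B ^ (46 * T)    ≡⟨ ^-distribˡ-+-* B T (46 * T) ⟨
    B ^ (47 * T)            ≡⟨ cong (B ^_) (*-comm 47 T) ⟩
    B ^ (T * 47)            ≡⟨ ^-*-assoc B T 47 ⟨
    (B ^ T) ^ 47            ≡⟨ cong (_^ 47) P^Q≡B^T ⟨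
    (P ^ Q) ^ 47            ≡⟨ ^-*-assoc P Q 47 ⟩
    P ^ (Q * 47)            ≡⟨ cong (P ^_) (*-comm Q 47) ⟩
    P ^ (47 * Q)            ≡⟨ ^-*-assoc P 47 Q ⟨
    (P ^ 47) ^ Q            ≤⟨ ^-monoˡ-≤ Q abc ⟩
    (K * r ^ 48) ^ Q        ≡⟨ ^-distrib-* K (r ^ 48) Q ⟩
    K ^ Q * (r ^ 48) ^ Q    ≡⟨ cong (K ^ Q *_) (^-*-assoc r 48 Q) ⟩
    K ^ Q * r ^ (48 * Q)    ≡⟨ cong (λ e → K ^ Q * r ^ e) (*-comm 48 Q) ⟩
    K ^ Q * r ^ (Q * 48)    ≡⟨ cong (K ^ Q *_) (^-*-assoc r Q 48) ⟨
    K ^ Q * (r ^ Q) ^ 48    ≤⟨ *-monoʳ-≤ (K ^ Q) (^-monoˡ-≤ 48 r^Q≤B^S) ⟩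
    K ^ Q * (B ^ S) ^ 48    ≡⟨ cong (K ^ Q *_) (^-*-assoc B S 48) ⟩
    K ^ Q * B ^ (S * 48)    ≤⟨ *-monoʳ-≤ (K ^ Q) (^-monoʳ-≤ B 48S≤46T) ⟩
    K ^ Q * B ^ (46 * T)    ∎
    where 48S≤46T : S * 48 ≤ 46 * T
          48S≤46T = subst₂ _≤_ (double-left S) (double-right T) (*-monoʳ-≤ 2 gap)
            where double-left : ∀ S → 2 * (24 * S) ≡ S * 48
                  double-left = solve-∀
                  double-right : ∀ T → 2 * (23 * T) ≡ 46 * T
                  double-right = solve-∀

-- ε = 1/47 is chosen so that (1 + ε) S ≤ (46/47) T is exactly what ExponentGap provides.
ABC₄₇ : ℕ → Set
ABC₄₇ K = ∀ a b c → 1 ≤ a → 1 ≤ b → a + b ≡ c → Coprime a b → c ^ 47 ≤ K * rad (a * b * c) ^ 48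

abc⇒abc₄₇ : ABC → ∃[ K ] ABC₄₇ K
abc⇒abc₄₇ abc with C , bound ← abc 1 47 (s≤s z≤n) (s≤s z≤n) = C ^ 47 , bound

repdigit-primeDivisors : ∀ q n ℓ b y c → y ^ q ≡ c * repunit (b ^ ℓ) n →
  ∀ p → Prime p → p ∣ (b ^ ℓ ∸ 1) * repunit (b ^ ℓ) n * 1 * (b ^ ℓ) ^ n → p ∣ y * (b ^ ℓ ∸ 1) * b
repdigit-primeDivisors q n ℓ b y c yᵠ≡cR p pp p∣abc
  with euclidsLemma ((b ^ ℓ ∸ 1) * repunit (b ^ ℓ) n * 1) ((b ^ ℓ) ^ n) pp p∣abc
... | inj₂ p∣Bⁿ =
  ∣-trans (prime∣^⇒∣ b ℓ pp (prime∣^⇒∣ (b ^ ℓ) n pp p∣Bⁿ)) (n∣m*n (y * (b ^ ℓ ∸ 1)))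
... | inj₁ p∣a with euclidsLemma (b ^ ℓ ∸ 1) (repunit (b ^ ℓ) n) pp (subst (p ∣_) (*-identityʳ _) p∣a)
...   | inj₁ p∣B-1 = ∣-trans p∣B-1 (∣-trans (n∣m*n y) (m∣m*n b))
...   | inj₂ p∣R = ∣-trans (prime∣^⇒∣ y q pp (subst (p ∣_) (sym yᵠ≡cR) (∣-trans p∣R (n∣m*n c))))
                           (∣-trans (m∣m*n (b ^ ℓ ∸ 1)) (m∣m*n b))

repdigit-abc : ∀ {K} q n ℓ b y c → ABC₄₇ K → 2 ≤ n → 1 ≤ ℓ → 2 ≤ b → 1 ≤ y →
               y ^ q ≡ c * repunit (b ^ ℓ) n → ((b ^ ℓ) ^ n) ^ 47 ≤ K * (y * (b ^ ℓ ∸ 1) * b) ^ 48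
repdigit-abc {K} q n ℓ b y c abc 2≤n 1≤ℓ 2≤b 1≤y yᵠ≡cR = ≤-trans
  (abc ((B ∸ 1) * repunit B n) 1 (B ^ n) 1≤a (s≤s z≤n) (repunit-geometric n 1≤B) (Coprime.sym (1-coprimeTo _)))
  (*-monoʳ-≤ K (^-monoˡ-≤ 48 (rad≤ _ _ 1≤r (repdigit-primeDivisors q n ℓ b y c yᵠ≡cR))))
  where
  B = b ^ ℓ
  2≤B : 2 ≤ B
  2≤B = ≤-trans 2≤b (m≤m^n (≤-trans (s≤s z≤n) 2≤b) 1≤ℓ)
  1≤B : 1 ≤ B
  1≤B = ≤-trans (s≤s z≤n) 2≤B
  1≤B-1 : 1 ≤ B ∸ 1
  1≤B-1 = ∸-monoˡ-≤ 1 2≤B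
  1≤a : 1 ≤ (B ∸ 1) * repunit B n
  1≤a = *-mono-≤ 1≤B-1 (≤-trans (s≤s z≤n) (2≤repunit n 1≤B 2≤n))
  1≤r : 1 ≤ y * (B ∸ 1) * b
  1≤r = *-mono-≤ (*-mono-≤ 1≤y 1≤B-1) (≤-trans (s≤s z≤n) 2≤b)

*repunit<^ : ∀ {c B} n → c < B → c * repunit B n < B ^ n
*repunit<^ {c} {suc m} n (s≤s c≤m) = begin-strict
  c * repunit (suc m) n     ≤⟨ *-monoˡ-≤ (repunit (suc m) n) c≤m ⟩
  m * repunit (suc m) n     <⟨ m<m+n (m * repunit (suc m) n) (s≤s z≤n) ⟩
  m * repunit (suc m) n + 1 ≡⟨ repunit-geometric n (s≤s z≤n) ⟩
  suc m ^ n                 ∎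
  where open ≤-Reasoning

repdigit-rootBound : ∀ q n ℓ b y → y ^ q ≤ (b ^ ℓ) ^ n →
                     (y * (b ^ ℓ ∸ 1) * b) ^ (q * ℓ) ≤ (b ^ ℓ) ^ (n * ℓ + q * ℓ + q)
repdigit-rootBound q n ℓ b y yᵠ≤Bⁿ = begin
  (y * (B ∸ 1) * b) ^ (q * ℓ)                 ≡⟨ ^-distrib-* (y * (B ∸ 1)) b (q * ℓ) ⟩
  (y * (B ∸ 1)) ^ (q * ℓ) * b ^ (q * ℓ)       ≡⟨ cong₂ _*_ (^-distrib-* y (B ∸ 1) (q * ℓ)) bᵠˡ≡Bᵠ ⟩
  y ^ (q * ℓ) * (B ∸ 1) ^ (q * ℓ) * B ^ q
    ≤⟨ *-monoˡ-≤ (B ^ q) (*-mono-≤ yᵠˡ≤Bⁿˡ (^-monoˡ-≤ (q * ℓ) (m∸n≤m B 1))) ⟩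
  B ^ (n * ℓ) * B ^ (q * ℓ) * B ^ q           ≡⟨ cong (_* B ^ q) (^-distribˡ-+-* B (n * ℓ) (q * ℓ)) ⟨
  B ^ (n * ℓ + q * ℓ) * B ^ q                 ≡⟨ ^-distribˡ-+-* B (n * ℓ + q * ℓ) q ⟨
  B ^ (n * ℓ + q * ℓ + q)                     ∎
  where
  open ≤-Reasoning
  B = b ^ ℓ
  bᵠˡ≡Bᵠ : b ^ (q * ℓ) ≡ B ^ q
  bᵠˡ≡Bᵠ = trans (cong (b ^_) (*-comm q ℓ)) (sym (^-*-assoc b ℓ q))
  yᵠˡ≤Bⁿˡ : y ^ (q * ℓ) ≤ B ^ (n * ℓ)
  yᵠˡ≤Bⁿˡ = begin
    y ^ (q * ℓ) ≡⟨ ^-*-assoc y q ℓ ⟨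
    (y ^ q) ^ ℓ ≤⟨ ^-monoˡ-≤ ℓ yᵠ≤Bⁿ ⟩
    (B ^ n) ^ ℓ ≡⟨ ^-*-assoc B n ℓ ⟩
    B ^ (n * ℓ) ∎

repdigit-bounded : ∀ {K} q n ℓ b y c → ABC₄₇ K → 2 ≤ q → 2 ≤ n → 1 ≤ ℓ → 2 ≤ b → 1 ≤ y →
                   c < b ^ ℓ → ¬ Admissible q n ℓ → y ^ q ≡ c * repunit (b ^ ℓ) n → (b ^ ℓ) ^ n ≤ K
repdigit-bounded {K} q n ℓ b y c abc 2≤q 2≤n 1≤ℓ 2≤b 1≤y c<B inadmissible yᵠ≡cR =
  abc-squeeze (q * ℓ) (n * ℓ + q * ℓ + q) (n * (q * ℓ)) (*-mono-≤ (≤-trans (s≤s z≤n) 2≤q) 1≤ℓ) 1≤B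
    (repdigit-abc {K} q n ℓ b y c abc 2≤n 1≤ℓ 2≤b 1≤y yᵠ≡cR)
    (repdigit-rootBound q n ℓ b y (≤-trans (≤-reflexive yᵠ≡cR) (<⇒≤ (*repunit<^ n c<B))))
    (^-*-assoc (b ^ ℓ) n (q * ℓ))
    (inadmissible⇒exponentGap q n ℓ 2≤q 2≤n 1≤ℓ inadmissible)
  where
  1≤B : 1 ≤ b ^ ℓ
  1≤B = m^n>0 b {{>-nonZero (≤-trans (s≤s z≤n) 2≤b)}} ℓ

2≤^⇒2≤ : ∀ y q → 2 ≤ y ^ q → 2 ≤ y
2≤^⇒2≤ 0 0 (s≤s ())
2≤^⇒2≤ 0 (suc q) ()
2≤^⇒2≤ 1 q 2≤1ᵠ = contradiction (subst (2 ≤_) (^-zeroˡ q) 2≤1ᵠ) λ { (s≤s ()) }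
2≤^⇒2≤ (suc (suc y)) q _ = s≤s (s≤s z≤n)

repdigit-coordinates≤ : ∀ q n ℓ b y c → 2 ≤ q → 2 ≤ n → 1 ≤ ℓ → 2 ≤ b → 1 ≤ y → 1 ≤ c →
  c < b ^ ℓ → y ^ q ≡ c * repunit (b ^ ℓ) n →
  let P = (b ^ ℓ) ^ n in q ≤ P × n ≤ P × ℓ ≤ P × b ≤ P × y ≤ P × c ≤ P
repdigit-coordinates≤ q n ℓ b y c 2≤q 2≤n 1≤ℓ 2≤b 1≤y 1≤c c<B yᵠ≡cR =
  <⇒≤ (<-≤-trans (n<m^n q 2≤y) yᵠ≤P) , <⇒≤ (n<m^n n 2≤B) , <⇒≤ (<-≤-trans (n<m^n ℓ 2≤b) B≤P) ,
  ≤-trans b≤B B≤P , ≤-trans (m≤m^n 1≤y 1≤q) yᵠ≤P , ≤-trans (<⇒≤ c<B) B≤P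
  where
  B = b ^ ℓ
  1≤q : 1 ≤ q
  1≤q = ≤-trans (s≤s z≤n) 2≤q
  b≤B : b ≤ B
  b≤B = m≤m^n (≤-trans (s≤s z≤n) 2≤b) 1≤ℓ
  2≤B : 2 ≤ B
  2≤B = ≤-trans 2≤b b≤B
  B≤P : B ≤ B ^ n
  B≤P = m≤m^n (≤-trans (s≤s z≤n) 2≤B) (≤-trans (s≤s z≤n) 2≤n)
  yᵠ≤P : y ^ q ≤ B ^ n
  yᵠ≤P = ≤-trans (≤-reflexive yᵠ≡cR) (<⇒≤ (*repunit<^ n c<B))
  2≤y : 2 ≤ y
  2≤y = 2≤^⇒2≤ y q (≤-trans (*-mono-≤ 1≤c (2≤repunit n (≤-trans (s≤s z≤n) 2≤B) 2≤n))
                             (≤-reflexive (sym yᵠ≡cR)))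

CoordinatesBelow : ℕ → Tuple → Set
CoordinatesBelow N (q , n , ℓ , b , y , c) = q < N × n < N × ℓ < N × b < N × y < N × c < N

tuplesBelow : ℕ → List Tuple
tuplesBelow N = cartesianProduct U (cartesianProduct U (cartesianProduct U
                  (cartesianProduct U (cartesianProduct U U))))
  where U = upTo N

∈-tuplesBelow : ∀ {N} t → CoordinatesBelow N t → t ∈ tuplesBelow N
∈-tuplesBelow _ (q< , n< , ℓ< , b< , y< , c<) =
  ∈-cartesianProduct⁺ (∈-upTo⁺ q<) (∈-cartesianProduct⁺ (∈-upTo⁺ n<)
    (∈-cartesianProduct⁺ (∈-upTo⁺ ℓ<) (∈-cartesianProduct⁺ (∈-upTo⁺ b<)
      (∈-cartesianProduct⁺ (∈-upTo⁺ y<) (∈-upTo⁺ c<)))))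

inadmissibleRepdigitPower-bounded : ∀ {K} → ABC₄₇ K →
  (q n ℓ b y c : ℕ) → 2 ≤ q → 2 ≤ n → 1 ≤ ℓ → 2 ≤ b → 1 ≤ y →
  b ^ (ℓ ∸ 1) ≤ c → c < b ^ ℓ → ¬ Admissible q n ℓ →
  y ^ q * (b ^ ℓ ∸ 1) ≡ c * (b ^ (n * ℓ) ∸ 1) →
  CoordinatesBelow (suc K) (q , n , ℓ , b , y , c)
inadmissibleRepdigitPower-bounded {K} abc q n ℓ b y c 2≤q 2≤n 1≤ℓ 2≤b 1≤y bˡ⁻¹≤c c<bˡ inadmissible eq
  = let q≤P , n≤P , ℓ≤P , b≤P , y≤P , c≤P =
          repdigit-coordinates≤ q n ℓ b y c 2≤q 2≤n 1≤ℓ 2≤b 1≤y 1≤c c<bˡ yᵠ≡cR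
    in ≤K q≤P , ≤K n≤P , ≤K ℓ≤P , ≤K b≤P , ≤K y≤P , ≤K c≤P
  where
  1≤b : 1 ≤ b
  1≤b = ≤-trans (s≤s z≤n) 2≤b
  yᵠ≡cR : y ^ q ≡ c * repunit (b ^ ℓ) n
  yᵠ≡cR = repunit-equation c n (≤-trans 2≤b (m≤m^n 1≤b 1≤ℓ)) (begin
    y ^ q * (b ^ ℓ ∸ 1)       ≡⟨ eq ⟩
    c * (b ^ (n * ℓ) ∸ 1)     ≡⟨ cong (λ e → c * (b ^ e ∸ 1)) (*-comm n ℓ) ⟩
    c * (b ^ (ℓ * n) ∸ 1)     ≡⟨ cong (λ z → c * (z ∸ 1)) (^-*-assoc b ℓ n) ⟨
    c * ((b ^ ℓ) ^ n ∸ 1)     ∎)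
    where open ≡-Reasoning
  1≤c : 1 ≤ c
  1≤c = ≤-trans (m^n>0 b {{>-nonZero 1≤b}} (ℓ ∸ 1)) bˡ⁻¹≤c
  ≤K : ∀ {x} → x ≤ (b ^ ℓ) ^ n → x < suc K
  ≤K x≤P = s≤s (≤-trans x≤P
    (repdigit-bounded q n ℓ b y c abc 2≤q 2≤n 1≤ℓ 2≤b 1≤y c<bˡ inadmissible yᵠ≡cR))

inadmissibleRepdigitPowers-finite : ABC →
  ∃[ L ] ((q n ℓ b y c : ℕ) → 2 ≤ q → 2 ≤ n → 1 ≤ ℓ → 2 ≤ b → 1 ≤ y →
    b ^ (ℓ ∸ 1) ≤ c → c < b ^ ℓ → ¬ Admissible q n ℓ →
    y ^ q * (b ^ ℓ ∸ 1) ≡ c * (b ^ (n * ℓ) ∸ 1) →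
    (q , n , ℓ , b , y , c) ∈ L)
inadmissibleRepdigitPowers-finite abc with K , abc₄₇ ← abc⇒abc₄₇ abc =
  tuplesBelow (suc K) , λ q n ℓ b y c 2≤q 2≤n 1≤ℓ 2≤b 1≤y bˡ⁻¹≤c c<bˡ inadmissible eq →
    ∈-tuplesBelow _ (inadmissibleRepdigitPower-bounded {K} abc₄₇ q n ℓ b y c
                       2≤q 2≤n 1≤ℓ 2≤b 1≤y bˡ⁻¹≤c c<bˡ inadmissible eq)

-- Base-b representations of repdigits

fromDigits : ℕ → List ℕ → ℕ
fromDigits b = foldl (λ acc d → acc * b + d) 0

fromDigits-++ : ∀ b xs ys → fromDigits b (xs ++ ys) ≡ fromDigits b xs * b ^ length ys + fromDigits b ys
fromDigits-++ b xs ys = trans (foldl-++ _ 0 xs ys) (fromAccumulator (fromDigits b xs) ys)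
  where
  fromAccumulator : ∀ a ys → foldl (λ acc d → acc * b + d) a ys ≡ a * b ^ length ys + fromDigits b ys
  fromAccumulator a [] = sym (trans (+-identityʳ _) (*-identityʳ a))
  fromAccumulator a (y ∷ ys) = begin
    foldl _ (a * b + y) ys                          ≡⟨ fromAccumulator (a * b + y) ys ⟩
    (a * b + y) * b ^ length ys + fromDigits b ys   ≡⟨ shift a b y (b ^ length ys) (fromDigits b ys) ⟩
    a * (b * b ^ length ys) + ((0 * b + y) * b ^ length ys + fromDigits b ys)
      ≡⟨ cong (a * (b * b ^ length ys) +_) (fromAccumulator (0 * b + y) ys) ⟨
    a * (b * b ^ length ys) + fromDigits b (y ∷ ys) ∎
    where open ≡-Reasoning
          shift : ∀ a b y X V → (a * b + y) * X + V ≡ a * (b * X) + ((0 * b + y) * X + V)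
          shift = solve-∀

fromDigits-∷ʳ : ∀ b ws d → fromDigits b (ws ++ [ d ]) ≡ fromDigits b ws * b + d
fromDigits-∷ʳ b ws d = foldl-++ _ 0 ws [ d ]

[m*n+o]/n≡m : ∀ m {n o} .{{_ : NonZero n}} → o < n → (m * n + o) / n ≡ m
[m*n+o]/n≡m m {n} {o} o<n = begin
  (m * n + o) / n     ≡⟨ +-distrib-/-∣ˡ o (n∣m*n m) ⟩
  m * n / n + o / n   ≡⟨ cong₂ _+_ (m*n/n≡m m n) (m<n⇒m/n≡0 o<n) ⟩
  m + 0               ≡⟨ +-identityʳ m ⟩
  m                   ∎
  where open ≡-Reasoning

[m*n+o]%n≡o : ∀ m {n o} .{{_ : NonZero n}} → o < n → (m * n + o) % n ≡ o
[m*n+o]%n≡o m {n} {o} o<n = begin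
  (m * n + o) % n   ≡⟨ cong (_% n) (+-comm (m * n) o) ⟩
  (o + m * n) % n   ≡⟨ [m+kn]%n≡m%n o m n ⟩
  o % n             ≡⟨ m<n⇒m%n≡m o<n ⟩
  o                 ∎
  where open ≡-Reasoning

leadingPart-bound : ∀ {b V d} j → d < b → b ^ suc j ≤ V * b + d → b ^ j ≤ V
leadingPart-bound {b} {V} {d} j d<b bʲ⁺¹≤N = s≤s⁻¹ (*-cancelʳ-< b (b ^ j) (suc V) (begin-strict
  b ^ j * b   ≡⟨ *-comm (b ^ j) b ⟩
  b ^ suc j   ≤⟨ bʲ⁺¹≤N ⟩
  V * b + d   <⟨ +-monoʳ-< (V * b) d<b ⟩
  V * b + b   ≡⟨ +-comm (V * b) b ⟩
  suc V * b   ∎))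
  where open ≤-Reasoning

digitsAux-0 : ∀ k f → digitsAux k f 0 ≡ []
digitsAux-0 k zero = refl
digitsAux-0 k (suc f) = refl

digitsAux-step : ∀ k {f N} → 1 ≤ N → N ≤ f →
                 digitsAux k f N ≡ digitsAux k (f ∸ 1) (N / suc k) ++ [ N % suc k ]
digitsAux-step k {suc f} {suc N} _ _ = refl

digitsAux-digit : ∀ k {f d} → d < suc k → 1 ≤ d → d ≤ f → digitsAux k f d ≡ [ d ]
digitsAux-digit k {f} {d} d<b 1≤d d≤f = begin
  digitsAux k f d                                  ≡⟨ digitsAux-step k 1≤d d≤f ⟩
  digitsAux k (f ∸ 1) (d / suc k) ++ [ d % suc k ] ≡⟨ cong₂ (λ u v → digitsAux k (f ∸ 1) u ++ [ v ])
                                                             (m<n⇒m/n≡0 d<b) (m<n⇒m%n≡m d<b) ⟩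
  digitsAux k (f ∸ 1) 0 ++ [ d ]                   ≡⟨ cong (_++ [ d ]) (digitsAux-0 k (f ∸ 1)) ⟩
  [ d ]                                            ∎
  where open ≡-Reasoning

digitsAux-fromDigits : ∀ k {w} → 1 ≤ k → Reverse w → All (_< suc k) w →
  suc k ^ (length w ∸ 1) ≤ fromDigits (suc k) w → ∀ f → fromDigits (suc k) w ≤ f →
  digitsAux k f (fromDigits (suc k) w) ≡ w
digitsAux-fromDigits k _ [] _ () _ _
digitsAux-fromDigits k _ (_ ∶ [] ∶ʳ d) (d<b ∷ []) 1≤d f d≤f = digitsAux-digit k d<b 1≤d d≤f
digitsAux-fromDigits k 1≤k (ws ∶ rws@(xs ∶ _ ∶ʳ _) ∶ʳ d) digits<b leading f N≤f = begin
  digitsAux k f (fromDigits b (ws ++ [ d ]))   ≡⟨ cong (digitsAux k f) N≡Vb+d ⟩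
  digitsAux k f (V * b + d)                    ≡⟨ digitsAux-step k (<-≤-trans (s≤s z≤n) V<N) Vb+d≤f ⟩
  digitsAux k (f ∸ 1) ((V * b + d) / b) ++ [ (V * b + d) % b ]
    ≡⟨ cong₂ (λ u v → digitsAux k (f ∸ 1) u ++ [ v ]) ([m*n+o]/n≡m V d<b) ([m*n+o]%n≡o V d<b) ⟩
  digitsAux k (f ∸ 1) V ++ [ d ]
    ≡⟨ cong (_++ [ d ]) (digitsAux-fromDigits k 1≤k rws ws<b leadingV (f ∸ 1) V≤f-1) ⟩
  ws ++ [ d ]                                  ∎
  where
  open ≡-Reasoning
  b = suc k
  V = fromDigits b ws
  N≡Vb+d : fromDigits b (ws ++ [ d ]) ≡ V * b + d
  N≡Vb+d = fromDigits-∷ʳ b ws d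
  ws<b : All (_< b) ws
  ws<b = proj₁ (∷ʳ⁻ digits<b)
  d<b : d < b
  d<b = proj₂ (∷ʳ⁻ digits<b)
  |ws|≡1+|xs| : length ws ≡ suc (length xs)
  |ws|≡1+|xs| = trans (length-++ xs) (+-comm (length xs) 1)
  |w|-1≡1+|xs| : length (ws ++ [ d ]) ∸ 1 ≡ suc (length xs)
  |w|-1≡1+|xs| = trans (cong (_∸ 1) (length-++ ws)) (trans (m+n∸n≡m (length ws) 1) |ws|≡1+|xs|)
  leadingV : b ^ (length ws ∸ 1) ≤ V
  leadingV = subst (λ e → b ^ (e ∸ 1) ≤ V) (sym |ws|≡1+|xs|)
               (leadingPart-bound (length xs) d<b (subst₂ _≤_ (cong (b ^_) |w|-1≡1+|xs|) N≡Vb+d leading))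
  V<N : V < V * b + d
  V<N = <-≤-trans (m<m*n V b {{>-nonZero (≤-trans (m^n>0 b (length ws ∸ 1)) leadingV)}} (s≤s 1≤k))
                  (m≤m+n (V * b) d)
  Vb+d≤f : V * b + d ≤ f
  Vb+d≤f = subst (_≤ f) N≡Vb+d N≤f
  V≤f-1 : V ≤ f ∸ 1
  V≤f-1 = ∸-monoˡ-≤ 1 (≤-trans V<N Vb+d≤f)

rep-fromDigits : ∀ {b w} → 2 ≤ b → All (_< b) w → b ^ (length w ∸ 1) ≤ fromDigits b w →
                 rep b (fromDigits b w) ≡ w
rep-fromDigits {suc k} {w} (s≤s 1≤k) digits<b leading =
  digitsAux-fromDigits k 1≤k (reverseView w) digits<b leading (fromDigits (suc k) w) ≤-refl

length-↑ : ∀ (w : List ℕ) n → length (w ↑ n) ≡ n * length w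
length-↑ w zero = refl
length-↑ w (suc n) = trans (length-++ w) (cong (length w +_) (length-↑ w n))

All-↑ : ∀ {P : ℕ → Set} {w} n → All P w → All P (w ↑ n)
All-↑ n Pw = concat⁺ (replicate⁺ n Pw)

fromDigits-↑ : ∀ b w n → fromDigits b (w ↑ n) ≡ fromDigits b w * repunit (b ^ length w) n
fromDigits-↑ b w zero = sym (*-zeroʳ (fromDigits b w))
fromDigits-↑ b w (suc n) = begin
  fromDigits b (w ++ w ↑ n)                 ≡⟨ fromDigits-++ b w (w ↑ n) ⟩
  V * b ^ length (w ↑ n) + fromDigits b (w ↑ n) ≡⟨ cong₂ (λ e r → V * b ^ e + r) (length-↑ w n) (fromDigits-↑ b w n) ⟩
  V * b ^ (n * ℓ) + V * R n                 ≡⟨ cong (λ e → V * b ^ e + V * R n) (*-comm n ℓ) ⟩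
  V * b ^ (ℓ * n) + V * R n                 ≡⟨ cong (λ z → V * z + V * R n) (^-*-assoc b ℓ n) ⟨
  V * (b ^ ℓ) ^ n + V * R n                 ≡⟨ *-distribˡ-+ V ((b ^ ℓ) ^ n) (R n) ⟨
  V * R (suc n)                             ∎
  where open ≡-Reasoning
        V = fromDigits b w
        ℓ = length w
        R = repunit (b ^ ℓ)

paddedDigits : (b : ℕ) .{{_ : NonZero b}} → ℕ → ℕ → List ℕ
paddedDigits b zero c = []
paddedDigits b (suc L) c = paddedDigits b L (c / b) ++ [ c % b ]

module _ (b : ℕ) .{{_ : NonZero b}} where

  length-paddedDigits : ∀ L c → length (paddedDigits b L c) ≡ L
  length-paddedDigits zero c = refl
  length-paddedDigits (suc L) c =
    trans (length-++ (paddedDigits b L (c / b))) (trans (cong (_+ 1) (length-paddedDigits L (c / b))) (+-comm L 1))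

  paddedDigits<b : ∀ L c → All (_< b) (paddedDigits b L c)
  paddedDigits<b zero c = []
  paddedDigits<b (suc L) c = ++⁺ (paddedDigits<b L (c / b)) (m%n<n c b ∷ [])

  fromDigits-paddedDigits : ∀ L c → c < b ^ L → fromDigits b (paddedDigits b L c) ≡ c
  fromDigits-paddedDigits zero zero _ = refl
  fromDigits-paddedDigits zero (suc c) (s≤s ())
  fromDigits-paddedDigits (suc L) c c<bᴸ⁺¹ = begin
    fromDigits b (paddedDigits b L (c / b) ++ [ c % b ])  ≡⟨ fromDigits-∷ʳ b (paddedDigits b L (c / b)) (c % b) ⟩
    fromDigits b (paddedDigits b L (c / b)) * b + c % b
      ≡⟨ cong (λ z → z * b + c % b) (fromDigits-paddedDigits L (c / b) c/b<bᴸ) ⟩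
    c / b * b + c % b                                     ≡⟨ +-comm (c / b * b) (c % b) ⟩
    c % b + c / b * b                                     ≡⟨ m≡m%n+[m/n]*n c b ⟨
    c                                                     ∎
    where open ≡-Reasoning
          c/b<bᴸ : c / b < b ^ L
          c/b<bᴸ = m<n*o⇒m/o<n (subst (c <_) (*-comm b (b ^ L)) c<bᴸ⁺¹)

repunit-leading : ∀ {b c} ℓ n → 1 ≤ ℓ → 1 ≤ n → b ^ (ℓ ∸ 1) ≤ c →
                  b ^ (n * ℓ ∸ 1) ≤ c * repunit (b ^ ℓ) n
repunit-leading {b} {c} (suc ℓ) (suc n) _ _ bˡ≤c = begin
  b ^ (ℓ + n * suc ℓ)                        ≡⟨ ^-distribˡ-+-* b ℓ (n * suc ℓ) ⟩
  b ^ ℓ * b ^ (n * suc ℓ)                    ≤⟨ *-monoˡ-≤ (b ^ (n * suc ℓ)) bˡ≤c ⟩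
  c * b ^ (n * suc ℓ)                        ≡⟨ cong (λ e → c * b ^ e) (*-comm n (suc ℓ)) ⟩
  c * b ^ (suc ℓ * n)                        ≡⟨ cong (c *_) (^-*-assoc b (suc ℓ) n) ⟨
  c * (b ^ suc ℓ) ^ n                        ≤⟨ *-monoʳ-≤ c (m≤m+n _ _) ⟩
  c * repunit (b ^ suc ℓ) (suc n)            ∎
  where open ≤-Reasoning

repdigitRepresentation : ∀ {b ℓ n c m} → 2 ≤ b → 1 ≤ ℓ → 1 ≤ n → b ^ (ℓ ∸ 1) ≤ c → c < b ^ ℓ →
  m ≡ c * repunit (b ^ ℓ) n → ∃[ w ] (All (_< b) w × length w ≡ ℓ × rep b m ≡ w ↑ n)
repdigitRepresentation {b} {ℓ} {n} {c} {m} 2≤b 1≤ℓ 1≤n bˡ⁻¹≤c c<bˡ m≡cR =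
  w , paddedDigits<b b ℓ c , |w|≡ℓ , (begin
    rep b m                  ≡⟨ cong (rep b) (trans m≡cR (sym value)) ⟩
    rep b (fromDigits b (w ↑ n)) ≡⟨ rep-fromDigits 2≤b (All-↑ n (paddedDigits<b b ℓ c)) leading ⟩
    w ↑ n                    ∎)
  where
  open ≡-Reasoning
  instance
    b≢0 : NonZero b
    b≢0 = >-nonZero (≤-trans (s≤s z≤n) 2≤b)
  w = paddedDigits b ℓ c
  |w|≡ℓ : length w ≡ ℓ
  |w|≡ℓ = length-paddedDigits b ℓ c
  value : fromDigits b (w ↑ n) ≡ c * repunit (b ^ ℓ) n
  value = trans (fromDigits-↑ b w n)
                (cong₂ (λ v e → v * repunit (b ^ e) n) (fromDigits-paddedDigits b ℓ c c<bˡ) |w|≡ℓ)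
  leading : b ^ (length (w ↑ n) ∸ 1) ≤ fromDigits b (w ↑ n)
  leading = subst₂ (λ e v → b ^ (e ∸ 1) ≤ v) (sym (trans (length-↑ w n) (cong (n *_) |w|≡ℓ))) (sym value)
              (repunit-leading ℓ n 1≤ℓ 1≤n bˡ⁻¹≤c)

-- Infinite families for admissible triples

record RepdigitSolution (q n ℓ b : ℕ) : Set where
  field
    y c : ℕ
    2≤b : 2 ≤ b
    1≤y : 1 ≤ y
    leading : b ^ (ℓ ∸ 1) ≤ c
    c<bˡ : c < b ^ ℓ
    equation : y ^ q ≡ c * repunit (b ^ ℓ) n

LargeRepdigitPower : ℕ → ℕ → ℕ → ℕ → Set
LargeRepdigitPower q n ℓ N = ∃[ b ] ∃[ y ] (2 ≤ b × 1 ≤ y × (N ≤ b ⊎ N ≤ y) ×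
  ∃[ w ] (All (_< b) w × length w ≡ ℓ × rep b (y ^ q) ≡ w ↑ n))

solution⇒large : ∀ {q n ℓ b N} → 1 ≤ ℓ → 1 ≤ n → (sol : RepdigitSolution q n ℓ b) →
                 N ≤ b ⊎ N ≤ RepdigitSolution.y sol → LargeRepdigitPower q n ℓ N
solution⇒large {b = b} 1≤ℓ 1≤n sol large =
  b , y , 2≤b , 1≤y , large , repdigitRepresentation 2≤b 1≤ℓ 1≤n leading c<bˡ equation
  where open RepdigitSolution sol

-- A sequence of integer points on a conic, generated by a unit of the underlying Pell equation.
record Orbit : Set₁ where
  field
    Invariant      : ℕ × ℕ → Set
    seed           : ℕ × ℕ
    seed-invariant : Invariant seed
    next           : ℕ × ℕ → ℕ × ℕ
    next-invariant : ∀ {s} → Invariant s → Invariant (next s)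
    base           : ℕ × ℕ → ℕ
    base-next      : ∀ {s} → Invariant s → base s < base (next s)

  unbounded : ∀ N → ∃[ s ] (Invariant s × N ≤ base s)
  unbounded zero = seed , seed-invariant , z≤n
  unbounded (suc N) with s , inv , N≤base ← unbounded N =
    next s , next-invariant inv , ≤-<-trans N≤base (base-next inv)

orbit⇒large : ∀ {q n ℓ} (O : Orbit) → 1 ≤ ℓ → 1 ≤ n →
  (∀ {s} → Orbit.Invariant O s → RepdigitSolution q n ℓ (Orbit.base O s)) →
  ∀ N → LargeRepdigitPower q n ℓ N
orbit⇒large O 1≤ℓ 1≤n solution N with s , inv , N≤base ← Orbit.unbounded O N =
  solution⇒large 1≤ℓ 1≤n (solution inv) (inj₁ N≤base)

invariant-transfer : ∀ {a a′ x y} → a + y ≡ a′ + x → x ≡ y → a ≡ a′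
invariant-transfer {a} {a′} {x} a+x≡a′+x refl = +-cancelʳ-≡ x a a′ a+x≡a′+x

1≤m≤2*n⇒1≤n : ∀ {m} n → 1 ≤ m → m ≤ 2 * n → 1 ≤ n
1≤m≤2*n⇒1≤n zero 1≤m m≤0 = ≤-trans 1≤m m≤0
1≤m≤2*n⇒1≤n (suc n) _ _ = s≤s z≤n

-- States (k , v) encode x = 2k + 1, so the invariant is (x² + 1)/2 = v²; next is (x , v) ↦ (3x + 4v , 2x + 3v).
module Orbit-x²+1=2v² where

  Invariant : ℕ × ℕ → Set
  Invariant (k , v) = 2 * (k * k) + 2 * k + 1 ≡ v * v × 3 ≤ k × 2 * k + 1 ≤ 2 * v × v ≤ 2 * k + 1

  next : ℕ × ℕ → ℕ × ℕ
  next (k , v) = 3 * k + 1 + 2 * v , 4 * k + 2 + 3 * v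

  next-invariant : ∀ {s} → Invariant s → Invariant (next s)
  next-invariant {k , v} (conic , 3≤k , x≤2v , v≤x) =
    invariant-transfer (conic-next k v) conic ,
    ≤-trans 3≤k (+-witness⇒≤ (k≤k′ k v)) , +-witness⇒≤ (x′≤2v′ k v) , +-witness⇒≤ (v′≤x′ k v)
    where
    conic-next : ∀ k v → 2 * ((3 * k + 1 + 2 * v) * (3 * k + 1 + 2 * v)) + 2 * (3 * k + 1 + 2 * v) + 1 + v * v
                       ≡ (4 * k + 2 + 3 * v) * (4 * k + 2 + 3 * v) + (2 * (k * k) + 2 * k + 1)
    conic-next = solve-∀
    k≤k′ : ∀ k v → k + (2 * k + 1 + 2 * v) ≡ 3 * k + 1 + 2 * v
    k≤k′ = solve-∀
    x′≤2v′ : ∀ k v → 2 * (3 * k + 1 + 2 * v) + 1 + (2 * k + 1 + 2 * v) ≡ 2 * (4 * k + 2 + 3 * v)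
    x′≤2v′ = solve-∀
    v′≤x′ : ∀ k v → 4 * k + 2 + 3 * v + (2 * k + 1 + v) ≡ 2 * (3 * k + 1 + 2 * v) + 1
    v′≤x′ = solve-∀

  orbit : Orbit
  orbit = record
    { Invariant = Invariant
    ; seed = 3 , 5
    ; seed-invariant = refl , ≤-refl , +-witness⇒≤ refl , +-witness⇒≤ refl
    ; next = next
    ; next-invariant = next-invariant
    ; base = λ (k , v) → 2 * k + 1
    ; base-next = λ {(k , v)} _ → +-witness⇒≤ (x<x′ k v)
    }
    where x<x′ : ∀ k v → suc (2 * k + 1) + (4 * k + 1 + 4 * v) ≡ 2 * (3 * k + 1 + 2 * v) + 1
          x<x′ = solve-∀

  module _ {k v : ℕ} (inv : Invariant (k , v)) where

    private
      x : ℕ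
      x = 2 * k + 1
      conic : 2 * (k * k) + 2 * k + 1 ≡ v * v
      conic = proj₁ inv
      7≤x : 7 ≤ x
      7≤x = +-monoˡ-≤ 1 (*-monoʳ-≤ 2 (proj₁ (proj₂ inv)))
      x≤2v : x ≤ 2 * v
      x≤2v = proj₁ (proj₂ (proj₂ inv))
      v≤x : v ≤ x
      v≤x = proj₂ (proj₂ (proj₂ inv))
      1≤v : 1 ≤ v
      1≤v = 1≤m≤2*n⇒1≤n v (m≤n+m 1 (2 * k)) x≤2v

    solution-3-2-2 : RepdigitSolution 3 2 2 x
    solution-3-2-2 = record
      { y = 2 * v
      ; c = 4 * v
      ; 2≤b = ≤-trans (s≤s (s≤s z≤n)) 7≤x
      ; 1≤y = ≤-trans 1≤v (m≤n*m v 2)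
      ; leading = subst (_≤ 4 * v) (sym (^-1 x)) (≤-trans x≤2v (*-monoˡ-≤ v (m≤m+n 2 2)))
      ; c<bˡ = subst (4 * v <_) (sym (^-2 x)) (begin-strict
          4 * v  ≤⟨ *-monoʳ-≤ 4 v≤x ⟩
          4 * x  <⟨ m<n+m (4 * x) (≤-trans (s≤s z≤n) 7≤x) ⟩
          5 * x  ≤⟨ *-monoˡ-≤ x (≤-trans (s≤s (s≤s (s≤s (s≤s (s≤s z≤n))))) 7≤x) ⟩
          x * x  ∎)
      ; equation = begin-equality
          (2 * v) ^ 3                             ≡⟨ ^-3 (2 * v) ⟩
          2 * v * (2 * v) * (2 * v)               ≡⟨ cube v ⟩
          4 * v * (2 * (v * v))                   ≡⟨ cong (λ z → 4 * v * (2 * z)) conic ⟨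
          4 * v * (2 * (2 * (k * k) + 2 * k + 1)) ≡⟨ cong (4 * v *_) (square k) ⟩
          4 * v * (x * x + 1)                     ≡⟨ cong (λ z → 4 * v * (z + 1)) (^-2 x) ⟨
          4 * v * (x ^ 2 + 1)                     ≡⟨ cong (4 * v *_) (repunit-2 (x ^ 2)) ⟨
          4 * v * repunit (x ^ 2) 2               ∎
      }
      where
      open ≤-Reasoning
      cube : ∀ v → 2 * v * (2 * v) * (2 * v) ≡ 4 * v * (2 * (v * v))
      cube = solve-∀
      square : ∀ k → 2 * (2 * (k * k) + 2 * k + 1) ≡ (2 * k + 1) * (2 * k + 1) + 1
      square = solve-∀

    solution-2-4-1 : RepdigitSolution 2 4 1 x
    solution-2-4-1 = record
      { y = (x + 1) * v
      ; c = k + 1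
      ; 2≤b = ≤-trans (s≤s (s≤s z≤n)) 7≤x
      ; 1≤y = *-mono-≤ (m≤n+m 1 x) 1≤v
      ; leading = m≤n+m 1 k
      ; c<bˡ = subst (k + 1 <_) (sym (^-1 x)) (+-monoˡ-< 1 (m<m+n k (≤-trans 1≤k (m≤m+n k 0))))
      ; equation = begin
          ((x + 1) * v) ^ 2                           ≡⟨ ^-2 ((x + 1) * v) ⟩
          (x + 1) * v * ((x + 1) * v)                 ≡⟨ regroup k v ⟩
          (k + 1) * ((x + 1) * (2 * (v * v)))         ≡⟨ cong (λ z → (k + 1) * ((x + 1) * (2 * z))) conic ⟨
          (k + 1) * ((x + 1) * (2 * (2 * (k * k) + 2 * k + 1))) ≡⟨ cong ((k + 1) *_) (factor k) ⟩
          (k + 1) * ((x + 1) * (x * x + 1))           ≡⟨ cong ((k + 1) *_) (repunit-4 x) ⟨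
          (k + 1) * repunit x 4                       ≡⟨ cong (λ B → (k + 1) * repunit B 4) (^-1 x) ⟨
          (k + 1) * repunit (x ^ 1) 4                 ∎
      }
      where
      open ≡-Reasoning
      1≤k : 1 ≤ k
      1≤k = ≤-trans (s≤s z≤n) (proj₁ (proj₂ inv))
      regroup : ∀ k v → (2 * k + 1 + 1) * v * ((2 * k + 1 + 1) * v) ≡ (k + 1) * ((2 * k + 1 + 1) * (2 * (v * v)))
      regroup = solve-∀
      factor : ∀ k → (2 * k + 1 + 1) * (2 * (2 * (k * k) + 2 * k + 1))
                     ≡ (2 * k + 1 + 1) * ((2 * k + 1) * (2 * k + 1) + 1)
      factor = solve-∀

-- Brahmagupta: (pX + DqY)² − D(qX + pY)² = (p² − Dq²)(X² − DY²), rearranged to avoid subtraction.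
pell-compose : ∀ {p q D X Y k} → p * p ≡ 1 + D * (q * q) → X * X + k ≡ D * (Y * Y) →
  (p * X + D * q * Y) * (p * X + D * q * Y) + k ≡ D * ((q * X + p * Y) * (q * X + p * Y))
pell-compose {p} {q} {D} {X} {Y} {k} unit conic = +-cancelʳ-≡ (X * X) _ _ (begin
  A + k + X * X      ≡⟨ swap A k (X * X) ⟩
  A + (X * X + k)    ≡⟨ cong (A +_) conic ⟩
  A + D * (Y * Y)    ≡⟨ +-cancelʳ-≡ Z _ _ (begin
    A + D * (Y * Y) + Z                                     ≡⟨ spreadˡ A D q X Y ⟩
    A + D * (q * q) * (X * X) + D * ((1 + D * (q * q)) * (Y * Y))
      ≡⟨ cong (λ u → A + D * (q * q) * (X * X) + D * (u * (Y * Y))) unit ⟨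
    A + D * (q * q) * (X * X) + D * (p * p * (Y * Y))       ≡⟨ brahmagupta p q D X Y ⟩
    B + p * p * (X * X) + D * (D * (q * q)) * (Y * Y)
      ≡⟨ cong (λ u → B + u * (X * X) + D * (D * (q * q)) * (Y * Y)) unit ⟩
    B + (1 + D * (q * q)) * (X * X) + D * (D * (q * q)) * (Y * Y) ≡⟨ spreadʳ B D q X Y ⟨
    B + X * X + Z                                           ∎) ⟩
  B + X * X          ∎)
  where
  open ≡-Reasoning
  A = (p * X + D * q * Y) * (p * X + D * q * Y)
  B = D * ((q * X + p * Y) * (q * X + p * Y))
  Z = D * (q * q) * (X * X) + D * (D * (q * q)) * (Y * Y)
  swap : ∀ A k x → A + k + x ≡ A + (x + k)
  swap = solve-∀
  spreadˡ : ∀ A D q X Y → A + D * (Y * Y) + (D * (q * q) * (X * X) + D * (D * (q * q)) * (Y * Y))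
                        ≡ A + D * (q * q) * (X * X) + D * ((1 + D * (q * q)) * (Y * Y))
  spreadˡ = solve-∀
  spreadʳ : ∀ B D q X Y → B + X * X + (D * (q * q) * (X * X) + D * (D * (q * q)) * (Y * Y))
                        ≡ B + (1 + D * (q * q)) * (X * X) + D * (D * (q * q)) * (Y * Y)
  spreadʳ = solve-∀
  brahmagupta : ∀ p q D X Y → (p * X + D * q * Y) * (p * X + D * q * Y) + D * (q * q) * (X * X) + D * (p * p * (Y * Y))
                            ≡ D * ((q * X + p * Y) * (q * X + p * Y)) + p * p * (X * X) + D * (D * (q * q)) * (Y * Y)
  brahmagupta = solve-∀

-- Solutions b ≡ r (mod M) of b² + b + 1 = d t², i.e. of (2b + 1)² + 3 = 4d t², generated by a unit
-- p = 2Ma + 1, q = Mq₀ of x² − 4d y² = 1; the congruences on p and q keep b ≡ r (mod M).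
module Orbit-b²+b+1=dt² (d M r a q₀ : ℕ)
  (unit : (2 * M * a + 1) * (2 * M * a + 1) ≡ 1 + 4 * d * (M * q₀ * (M * q₀))) (1≤M : 1 ≤ M) (1≤a : 1 ≤ a)
  (m₀ t₀ : ℕ) (seed-conic : (M * m₀ + r) * (M * m₀ + r) + (M * m₀ + r) + 1 ≡ d * (t₀ * t₀)) where

  base : ℕ × ℕ → ℕ
  base (m , t) = M * m + r

  Invariant : ℕ × ℕ → Set
  Invariant (m , t) = (M * m + r) * (M * m + r) + (M * m + r) + 1 ≡ d * (t * t)

  next : ℕ × ℕ → ℕ × ℕ
  next (m , t) = m + (2 * a * base (m , t) + a + 2 * d * q₀ * t) ,
                 M * q₀ * (2 * base (m , t) + 1) + (2 * M * a + 1) * t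

  completeSquare : ∀ b → (2 * b + 1) * (2 * b + 1) + 3 ≡ 4 * (b * b + b + 1)
  completeSquare = solve-∀

  next-invariant : ∀ {s} → Invariant s → Invariant (next s)
  next-invariant {m , t} conic = *-cancelˡ-≡ _ _ 4 (begin
    4 * (b′ * b′ + b′ + 1)               ≡⟨ completeSquare b′ ⟨
    (2 * b′ + 1) * (2 * b′ + 1) + 3      ≡⟨ cong (λ X → X * X + 3) X′≡pX+Dqt ⟩
    (p * X + D * q * t) * (p * X + D * q * t) + 3  ≡⟨ pell-compose {p} {q} {D} {X} {t} {3} unit X-conic ⟩
    D * (t′ * t′)                        ≡⟨ *-assoc 4 d (t′ * t′) ⟩
    4 * (d * (t′ * t′))                  ∎)
    where
    open ≡-Reasoning
    b = base (m , t)
    b′ = base (next (m , t))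
    t′ = M * q₀ * (2 * b + 1) + (2 * M * a + 1) * t
    p = 2 * M * a + 1
    q = M * q₀
    D = 4 * d
    X = 2 * b + 1
    X-conic : X * X + 3 ≡ D * (t * t)
    X-conic = trans (completeSquare b) (trans (cong (4 *_) conic) (sym (*-assoc 4 d (t * t))))
    X′≡pX+Dqt : 2 * b′ + 1 ≡ p * X + D * q * t
    X′≡pX+Dqt = shift M m r a d q₀ t
      where shift : ∀ M m r a d q₀ t →
                    2 * (M * (m + (2 * a * (M * m + r) + a + 2 * d * q₀ * t)) + r) + 1
                    ≡ (2 * M * a + 1) * (2 * (M * m + r) + 1) + 4 * d * (M * q₀) * t
            shift = solve-∀

  base-next : ∀ {s} → Invariant s → base s < base (next s)
  base-next {m , t} _ = +-monoˡ-< r (*-monoʳ-< M {{>-nonZero 1≤M}} (m<m+n m 1≤step))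
    where 1≤step = ≤-trans 1≤a (≤-trans (m≤n+m a (2 * a * base (m , t))) (m≤m+n _ (2 * d * q₀ * t)))

  1≤t : ∀ {m t} → Invariant (m , t) → 1 ≤ t
  1≤t {t = zero} conic = contradiction (trans (+-comm 1 _) (trans conic (*-zeroʳ d))) (λ ())
  1≤t {t = suc t} _ = s≤s z≤n

  orbit : Orbit
  orbit = record
    { Invariant = Invariant
    ; seed = m₀ , t₀
    ; seed-invariant = seed-conic
    ; next = next
    ; next-invariant = next-invariant
    ; base = base
    ; base-next = base-next
    }

-- b ≡ 19 (mod 49), starting from 313² + 313 + 1 = 3 · 181².
module Orbit-b²+b+1=3t² = Orbit-b²+b+1=dt² 3 49 19 545514866412333980323173442752 314953154970103762051969893128
                                           refl (s≤s z≤n) (s≤s z≤n) 6 181 refl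

module _ {m t : ℕ} (conic : Orbit-b²+b+1=3t².Invariant (m , t)) where

  private
    b : ℕ
    b = 49 * m + 19
    1≤t : 1 ≤ t
    1≤t = Orbit-b²+b+1=3t².1≤t {m} {t} conic
    2≤b : 2 ≤ b
    2≤b = ≤-trans (m≤m+n 2 17) (m≤n+m 19 (49 * m))
    e : ℕ
    e = 49 * (m * m) + 37 * m + 7

  solution-2-3-1 : RepdigitSolution 2 3 1 b
  solution-2-3-1 = record
    { y = 3 * t
    ; c = 3
    ; 2≤b = 2≤b
    ; 1≤y = ≤-trans 1≤t (m≤n*m t 3)
    ; leading = s≤s z≤n
    ; c<bˡ = subst (3 <_) (sym (^-1 b)) (≤-trans (m≤m+n 4 15) (m≤n+m 19 (49 * m)))
    ; equation = begin
        (3 * t) ^ 2            ≡⟨ ^-2 (3 * t) ⟩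
        3 * t * (3 * t)        ≡⟨ regroup t ⟩
        3 * (3 * (t * t))      ≡⟨ cong (3 *_) conic ⟨
        3 * (b * b + b + 1)    ≡⟨ cong (3 *_) (repunit-3 b) ⟨
        3 * repunit b 3        ≡⟨ cong (λ B → 3 * repunit B 3) (^-1 b) ⟨
        3 * repunit (b ^ 1) 3  ∎
    }
    where
    open ≡-Reasoning
    regroup : ∀ t → 3 * t * (3 * t) ≡ 3 * (3 * (t * t))
    regroup = solve-∀

  -- b ≡ 19 (mod 49) makes b² − b + 1 = 49e divisible by 49, and b⁴ + b² + 1 = (b² + b + 1)(b² − b + 1).
  solution-2-3-2 : RepdigitSolution 2 3 2 b
  solution-2-3-2 = record
    { y = 21 * t * e
    ; c = 3 * e
    ; 2≤b = 2≤b
    ; 1≤y = *-mono-≤ (≤-trans 1≤t (m≤n*m t 21)) (≤-trans (s≤s z≤n) (m≤n+m 7 (49 * (m * m) + 37 * m)))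
    ; leading = subst (_≤ 3 * e) (sym (^-1 b)) (+-witness⇒≤ (b≤3e m))
    ; c<bˡ = subst (3 * e <_) (sym (^-2 b)) (+-witness⇒≤ (3e<b² m))
    ; equation = begin
        (21 * t * e) ^ 2                     ≡⟨ ^-2 (21 * t * e) ⟩
        21 * t * e * (21 * t * e)            ≡⟨ regroup t e ⟩
        3 * e * (3 * (t * t) * (49 * e))     ≡⟨ cong (λ z → 3 * e * (z * (49 * e))) conic ⟨
        3 * e * ((b * b + b + 1) * (49 * e)) ≡⟨ cong (3 * e *_) (factor m) ⟩
        3 * e * (b * b * (b * b) + b * b + 1) ≡⟨ cong (λ B → 3 * e * (B * B + B + 1)) (^-2 b) ⟨
        3 * e * (b ^ 2 * b ^ 2 + b ^ 2 + 1)  ≡⟨ cong (3 * e *_) (repunit-3 (b ^ 2)) ⟨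
        3 * e * repunit (b ^ 2) 3            ∎
    }
    where
    open ≡-Reasoning
    b≤3e : ∀ m → 49 * m + 19 + (147 * (m * m) + 62 * m + 2) ≡ 3 * (49 * (m * m) + 37 * m + 7)
    b≤3e = solve-∀
    3e<b² : ∀ m → suc (3 * (49 * (m * m) + 37 * m + 7)) + (2254 * (m * m) + 1751 * m + 339)
                  ≡ (49 * m + 19) * (49 * m + 19)
    3e<b² = solve-∀
    regroup : ∀ t e → 21 * t * e * (21 * t * e) ≡ 3 * e * (3 * (t * t) * (49 * e))
    regroup = solve-∀
    factor : ∀ m → ((49 * m + 19) * (49 * m + 19) + (49 * m + 19) + 1) * (49 * (49 * (m * m) + 37 * m + 7))
                   ≡ (49 * m + 19) * (49 * m + 19) * ((49 * m + 19) * (49 * m + 19)) + (49 * m + 19) * (49 * m + 19) + 1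
    factor = solve-∀

-- Starting from 18² + 18 + 1 = 343.
module Orbit-b²+b+1=343W² = Orbit-b²+b+1=dt² 343 1 0 17050177433963583 920623046934552
                                             refl (s≤s z≤n) (s≤s z≤n) 18 1 refl

trinomial≡343*²⇒< : ∀ {b W} → b * b + b + 1 ≡ 343 * (W * W) → W < b
trinomial≡343*²⇒< {zero} {W} conic = contradiction (m*n≡1⇒m≡1 343 (W * W) (sym conic)) λ ()
trinomial≡343*²⇒< {suc b} {W} conic = ≰⇒> λ 1+b≤W →
  <⇒≱ (+-witness⇒≤ (gap b)) (≤-trans (*-monoʳ-≤ 343 (*-mono-≤ 1+b≤W 1+b≤W)) (≤-reflexive (sym conic)))
  where gap : ∀ b → suc (suc b * suc b + suc b + 1) + (339 + 683 * b + 342 * (b * b)) ≡ 343 * (suc b * suc b)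
        gap = solve-∀

solution-3-3-1 : ∀ {m W} → Orbit-b²+b+1=343W².Invariant (m , W) → RepdigitSolution 3 3 1 (1 * m + 0)
solution-3-3-1 {m} {W} conic = record
  { y = 7 * W
  ; c = W
  ; 2≤b = ≤-trans (s≤s 1≤W) W<b
  ; 1≤y = ≤-trans 1≤W (m≤n*m W 7)
  ; leading = 1≤W
  ; c<bˡ = subst (W <_) (sym (^-1 b)) W<b
  ; equation = begin
      (7 * W) ^ 3                ≡⟨ ^-3 (7 * W) ⟩
      7 * W * (7 * W) * (7 * W)  ≡⟨ regroup W ⟩
      W * (343 * (W * W))        ≡⟨ cong (W *_) conic ⟨
      W * (b * b + b + 1)        ≡⟨ cong (W *_) (repunit-3 b) ⟨
      W * repunit b 3            ≡⟨ cong (λ B → W * repunit B 3) (^-1 b) ⟨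
      W * repunit (b ^ 1) 3      ∎
  }
  where
  open ≡-Reasoning
  b = 1 * m + 0
  1≤W : 1 ≤ W
  1≤W = Orbit-b²+b+1=343W².1≤t {m} {W} conic
  W<b : W < b
  W<b = trinomial≡343*²⇒< {b} {W} conic
  regroup : ∀ W → 7 * W * (7 * W) * (7 * W) ≡ W * (343 * (W * W))
  regroup = solve-∀

-- Solutions of b² + 1 = 125v² under the unit 930249² − 125 · 83204² = 1, starting from 682² + 1 = 125 · 61².
module Orbit-b²+1=125v² where

  Invariant : ℕ × ℕ → Set
  Invariant (b , v) = b * b + 1 ≡ 125 * (v * v) × 3 ≤ v × b ≤ 12 * v × v ≤ b

  next : ℕ × ℕ → ℕ × ℕ
  next (b , v) = 930249 * b + 125 * 83204 * v , 83204 * b + 930249 * v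

  next-invariant : ∀ {s} → Invariant s → Invariant (next s)
  next-invariant {b , v} (conic , 3≤v , b≤12v , v≤b) =
    pell-compose {930249} {83204} {125} {b} {v} {1} refl conic ,
    ≤-trans 3≤v (≤-trans (m≤n*m v 930249) (m≤n+m _ (83204 * b))) ,
    +-witness⇒≤ (b′≤12v′ b v) , +-witness⇒≤ (v′≤b′ b v)
    where
    b′≤12v′ : ∀ b v → 930249 * b + 10400500 * v + (68199 * b + 762488 * v) ≡ 12 * (83204 * b + 930249 * v)
    b′≤12v′ = solve-∀
    v′≤b′ : ∀ b v → 83204 * b + 930249 * v + (847045 * b + 9470251 * v) ≡ 930249 * b + 10400500 * v
    v′≤b′ = solve-∀

  orbit : Orbit
  orbit = record
    { Invariant = Invariant
    ; seed = 682 , 61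
    ; seed-invariant = refl , +-witness⇒≤ refl , +-witness⇒≤ refl , +-witness⇒≤ refl
    ; next = next
    ; next-invariant = next-invariant
    ; base = proj₁
    ; base-next = λ {(b , v)} (_ , 3≤v , _) →
        <-≤-trans (m<m+n b (≤-trans (≤-trans (s≤s z≤n) 3≤v) (m≤n*m v (125 * 83204))))
                  (+-monoˡ-≤ (125 * 83204 * v) (m≤n*m b 930249))
    }

  solution-4-2-2 : ∀ {b v} → Invariant (b , v) → RepdigitSolution 4 2 2 b
  solution-4-2-2 {b} {v} (conic , 3≤v , b≤12v , v≤b) = record
    { y = 5 * v
    ; c = 5 * (v * v)
    ; 2≤b = ≤-trans (s≤s (s≤s z≤n)) (≤-trans 3≤v v≤b)
    ; 1≤y = ≤-trans 1≤v (m≤n*m v 5)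
    ; leading = subst (_≤ 5 * (v * v)) (sym (^-1 b)) (begin
        b            ≤⟨ b≤12v ⟩
        12 * v       ≤⟨ *-monoˡ-≤ v (m≤m+n 12 3) ⟩
        5 * 3 * v    ≡⟨ *-assoc 5 3 v ⟩
        5 * (3 * v)  ≤⟨ *-monoʳ-≤ 5 (*-monoˡ-≤ v 3≤v) ⟩
        5 * (v * v)  ∎)
    ; c<bˡ = subst (5 * (v * v) <_) (sym (^-2 b)) (+-cancelʳ-≤ 1 _ _ (begin
        suc (5 * (v * v)) + 1        ≡⟨ +-comm (suc (5 * (v * v))) 1 ⟩
        2 + 5 * (v * v)              ≤⟨ +-monoˡ-≤ (5 * (v * v)) (≤-trans (m≤m+n 2 118) (*-monoʳ-≤ 120 1≤v²)) ⟩
        120 * (v * v) + 5 * (v * v)  ≡⟨ *-distribʳ-+ (v * v) 120 5 ⟨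
        125 * (v * v)                ≡⟨ conic ⟨
        b * b + 1                    ∎))
    ; equation = begin-equality
        (5 * v) ^ 4                          ≡⟨ ^-4 (5 * v) ⟩
        5 * v * (5 * v) * (5 * v * (5 * v))  ≡⟨ regroup v ⟩
        5 * (v * v) * (125 * (v * v))        ≡⟨ cong (5 * (v * v) *_) conic ⟨
        5 * (v * v) * (b * b + 1)            ≡⟨ cong (λ B → 5 * (v * v) * (B + 1)) (^-2 b) ⟨
        5 * (v * v) * (b ^ 2 + 1)            ≡⟨ cong (5 * (v * v) *_) (repunit-2 (b ^ 2)) ⟨
        5 * (v * v) * repunit (b ^ 2) 2      ∎
    }
    where
    open ≤-Reasoning
    1≤v : 1 ≤ v
    1≤v = ≤-trans (s≤s z≤n) 3≤v
    1≤v² : 1 ≤ v * v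
    1≤v² = *-mono-≤ 1≤v 1≤v
    regroup : ∀ v → 5 * v * (5 * v) * (5 * v * (5 * v)) ≡ 5 * (v * v) * (125 * (v * v))
    regroup = solve-∀

-- Solutions b = 8m + 7 of b² − b + 1 = 3w², i.e. (2b − 1)² + 3 = 12w², under the unit 97² − 12 · 28² = 1,
-- starting from 23² − 23 + 1 = 3 · 13².
module Orbit-b²-b+1=3w² where

  Invariant : ℕ × ℕ → Set
  Invariant (m , w) = 64 * (m * m) + 104 * m + 43 ≡ 3 * (w * w) × 13 ≤ w × w ≤ 5 * m + 4

  next : ℕ × ℕ → ℕ × ℕ
  next (m , w) = 97 * m + 78 + 21 * w , 28 * (16 * m + 13) + 97 * w

  next-invariant : ∀ {s} → Invariant s → Invariant (next s)
  next-invariant {m , w} (conic , 13≤w , w≤5m+4) =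
    invariant-transfer (conic-next m w) conic ,
    ≤-trans 13≤w (≤-trans (m≤n*m w 97) (m≤n+m (97 * w) (28 * (16 * m + 13)))) ,
    +-witness⇒≤ (w′≤5m′+4 m w)
    where
    conic-next : ∀ m w → 64 * ((97 * m + 78 + 21 * w) * (97 * m + 78 + 21 * w)) + 104 * (97 * m + 78 + 21 * w) + 43
                         + 3 * (w * w)
                       ≡ 3 * ((28 * (16 * m + 13) + 97 * w) * (28 * (16 * m + 13) + 97 * w))
                         + (64 * (m * m) + 104 * m + 43)
    conic-next = solve-∀
    w′≤5m′+4 : ∀ m w → 28 * (16 * m + 13) + 97 * w + (37 * m + 30 + 8 * w) ≡ 5 * (97 * m + 78 + 21 * w) + 4
    w′≤5m′+4 = solve-∀

  seed-invariant : Invariant (2 , 13)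
  seed-invariant = refl , ≤-refl , +-witness⇒≤ refl

  base-next : ∀ {m w} → 8 * m + 7 < 8 * (97 * m + 78 + 21 * w) + 7
  base-next {m} {w} = +-witness⇒≤ (b<b′ m w)
    where b<b′ : ∀ m w → suc (8 * m + 7) + (768 * m + 623 + 168 * w) ≡ 8 * (97 * m + 78 + 21 * w) + 7
          b<b′ = solve-∀

  orbit : Orbit
  orbit = record
    { Invariant = Invariant
    ; seed = 2 , 13
    ; seed-invariant = seed-invariant
    ; next = next
    ; next-invariant = λ {s} inv → next-invariant {s} inv
    ; base = λ (m , w) → 8 * m + 7
    ; base-next = λ {(m , w)} _ → base-next {m} {w}
    }

  -- b³ + 1 = (b + 1)(b² − b + 1) = 8(m + 1) · 3w².
  solution-3-2-3 : ∀ {m w} → Invariant (m , w) → RepdigitSolution 3 2 3 (8 * m + 7)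
  solution-3-2-3 {m} {w} (conic , 13≤w , w≤5m+4) = record
    { y = 6 * w * (m + 1)
    ; c = 9 * ((m + 1) * (m + 1)) * w
    ; 2≤b = ≤-trans (m≤m+n 2 5) (m≤n+m 7 (8 * m))
    ; 1≤y = *-mono-≤ (≤-trans 1≤w (m≤n*m w 6)) (m≤n+m 1 m)
    ; leading = begin
        (8 * m + 7) ^ 2                  ≡⟨ ^-2 (8 * m + 7) ⟩
        (8 * m + 7) * (8 * m + 7)        ≤⟨ +-witness⇒≤ (b²≤72[m+1]² m) ⟩
        9 * ((m + 1) * (m + 1)) * 8      ≤⟨ *-monoʳ-≤ (9 * ((m + 1) * (m + 1))) (≤-trans (m≤m+n 8 5) 13≤w) ⟩
        9 * ((m + 1) * (m + 1)) * w      ∎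
    ; c<bˡ = begin-strict
        9 * ((m + 1) * (m + 1)) * w          ≤⟨ *-monoʳ-≤ (9 * ((m + 1) * (m + 1))) w≤5m+4 ⟩
        9 * ((m + 1) * (m + 1)) * (5 * m + 4) <⟨ +-witness⇒≤ (c<b³ m) ⟩
        (8 * m + 7) * (8 * m + 7) * (8 * m + 7) ≡⟨ ^-3 (8 * m + 7) ⟨
        (8 * m + 7) ^ 3                      ∎
    ; equation = begin-equality
        (6 * w * (m + 1)) ^ 3                                    ≡⟨ ^-3 (6 * w * (m + 1)) ⟩
        6 * w * (m + 1) * (6 * w * (m + 1)) * (6 * w * (m + 1))  ≡⟨ regroup m w ⟩
        c * (8 * (m + 1) * (3 * (w * w)))                        ≡⟨ cong (λ z → c * (8 * (m + 1) * z)) conic ⟨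
        c * (8 * (m + 1) * (64 * (m * m) + 104 * m + 43))        ≡⟨ cong (c *_) (sumOfCubes m) ⟩
        c * ((8 * m + 7) * (8 * m + 7) * (8 * m + 7) + 1)        ≡⟨ cong (λ B → c * (B + 1)) (^-3 (8 * m + 7)) ⟨
        c * ((8 * m + 7) ^ 3 + 1)                                ≡⟨ cong (c *_) (repunit-2 ((8 * m + 7) ^ 3)) ⟨
        c * repunit ((8 * m + 7) ^ 3) 2                          ∎
    }
    where
    open ≤-Reasoning
    c = 9 * ((m + 1) * (m + 1)) * w
    1≤w : 1 ≤ w
    1≤w = ≤-trans (s≤s z≤n) 13≤w
    b²≤72[m+1]² : ∀ m → (8 * m + 7) * (8 * m + 7) + (8 * (m * m) + 32 * m + 23) ≡ 9 * ((m + 1) * (m + 1)) * 8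
    b²≤72[m+1]² = solve-∀
    c<b³ : ∀ m → suc (9 * ((m + 1) * (m + 1)) * (5 * m + 4)) + (467 * (m * m * m) + 1218 * (m * m) + 1059 * m + 306)
                 ≡ (8 * m + 7) * (8 * m + 7) * (8 * m + 7)
    c<b³ = solve-∀
    regroup : ∀ m w → 6 * w * (m + 1) * (6 * w * (m + 1)) * (6 * w * (m + 1))
                      ≡ 9 * ((m + 1) * (m + 1)) * w * (8 * (m + 1) * (3 * (w * w)))
    regroup = solve-∀
    sumOfCubes : ∀ m → 8 * (m + 1) * (64 * (m * m) + 104 * m + 43) ≡ (8 * m + 7) * (8 * m + 7) * (8 * m + 7) + 1
    sumOfCubes = solve-∀

-- (q , n , ℓ) = (q , 2 , 1): with b = 2mᵠ − 1, (2m)ᵠ = 2ᵠ⁻¹ · (b + 1).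
solution-q-2-1 : ∀ p {m} → 1 ≤ p → 2 ≤ m → RepdigitSolution (suc p) 2 1 (2 * m ^ suc p ∸ 1)
solution-q-2-1 p {m} 1≤p 2≤m = record
  { y = 2 * m
  ; c = 2 ^ p
  ; 2≤b = ≤-trans (s≤s 1≤2ᵖ) 2ᵖ<b
  ; 1≤y = ≤-trans (s≤s z≤n) (≤-trans 2≤m (m≤n*m m 2))
  ; leading = 1≤2ᵖ
  ; c<bˡ = subst (2 ^ p <_) (sym (^-1 b)) 2ᵖ<b
  ; equation = begin
      (2 * m) ^ suc p          ≡⟨ ^-distrib-* 2 m (suc p) ⟩
      2 * 2 ^ p * m ^ suc p    ≡⟨ regroup (2 ^ p) (m ^ suc p) ⟩
      2 ^ p * (2 * m ^ suc p)  ≡⟨ cong (2 ^ p *_) b+1≡2mᵠ ⟨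
      2 ^ p * (b + 1)          ≡⟨ cong (λ B → 2 ^ p * (B + 1)) (^-1 b) ⟨
      2 ^ p * (b ^ 1 + 1)      ≡⟨ cong (2 ^ p *_) (repunit-2 (b ^ 1)) ⟨
      2 ^ p * repunit (b ^ 1) 2 ∎
  }
  where
  open ≡-Reasoning
  b = 2 * m ^ suc p ∸ 1
  1≤2ᵖ : 1 ≤ 2 ^ p
  1≤2ᵖ = m^n>0 2 p
  2ᵖ⁺¹≤mᵠ : 2 * 2 ^ p ≤ m ^ suc p
  2ᵖ⁺¹≤mᵠ = ^-monoˡ-≤ (suc p) 2≤m
  b+1≡2mᵠ : b + 1 ≡ 2 * m ^ suc p
  b+1≡2mᵠ = m∸n+n≡m (≤-trans (≤-trans 1≤2ᵖ (m≤n*m (2 ^ p) 2)) (≤-trans 2ᵖ⁺¹≤mᵠ (m≤n*m (m ^ suc p) 2)))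
  2ᵖ<b : 2 ^ p < b
  2ᵖ<b = +-cancelʳ-≤ 1 (suc (2 ^ p)) b
    (≤-trans (room (2 ^ p) 1≤2ᵖ) (≤-trans (*-monoʳ-≤ 2 2ᵖ⁺¹≤mᵠ) (≤-reflexive (sym b+1≡2mᵠ))))
    where room : ∀ Z → 1 ≤ Z → suc Z + 1 ≤ 2 * (2 * Z)
          room (suc z) _ = +-witness⇒≤ (identity z)
            where identity : ∀ z → suc (suc z) + 1 + (1 + 3 * z) ≡ 2 * (2 * suc z)
                  identity = solve-∀
  regroup : ∀ Z X → 2 * Z * X ≡ Z * (2 * X)
  regroup = solve-∀

binomialTail : (r M t i : ℕ) → ℕ
binomialTail r M t zero = 0
binomialTail r M t (suc i) = binomialTail r M t i * (r + M * t) + (1 + i) * r ^ i * (t * t)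

binomial-expansion : ∀ r M t i →
  (r + M * t) ^ suc i ≡ r ^ suc i + (1 + i) * r ^ i * M * t + M * M * binomialTail r M t i
binomial-expansion r M t zero = base r M t
  where base : ∀ r M t → (r + M * t) * 1 ≡ r * 1 + 1 * 1 * M * t + M * M * 0
        base = solve-∀
binomial-expansion r M t (suc i) =
  trans (cong ((r + M * t) *_) (binomial-expansion r M t i)) (step r M t (r ^ i) (binomialTail r M t i) i)
  where step : ∀ r M t X A i → (r + M * t) * (r * X + (1 + i) * X * M * t + M * M * A)
                               ≡ r * (r * X) + (1 + (1 + i)) * (r * X) * M * t
                                 + M * M * (A * (r + M * t) + (1 + i) * X * (t * t))
        step = solve-∀

-- With r = (i + 1)t, u = rⁱ⁺¹ and M = u + 1, the base b = r + Mt satisfies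
-- bⁱ⁺¹ ≡ rⁱ⁺¹ + uM = M² − 1 (mod M²), so bⁱ⁺¹ + 1 = M²(1 + A) and (uM(1 + A))² = u²(1 + A) · (bⁱ⁺¹ + 1).
module SquareFamily (i N : ℕ) where

  t r u M b A : ℕ
  t = N + 4
  r = (1 + i) * t
  u = r * r ^ i
  M = 1 + u
  b = r + M * t
  A = binomialTail r M t i

  bⁱ⁺¹+1≡M²[1+A] : b ^ suc i + 1 ≡ M * M * (1 + A)
  bⁱ⁺¹+1≡M²[1+A] = trans (cong (_+ 1) (binomial-expansion r M t i)) (square i t (r ^ i) A)
    where square : ∀ i t X A → (1 + i) * t * X + (1 + i) * X * (1 + (1 + i) * t * X) * t
                           + (1 + (1 + i) * t * X) * (1 + (1 + i) * t * X) * A + 1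
                           ≡ (1 + (1 + i) * t * X) * (1 + (1 + i) * t * X) * (1 + A)
          square = solve-∀

  1≤t : 1 ≤ t
  1≤t = ≤-trans (s≤s z≤n) (m≤n+m 4 N)

  1≤u : 1 ≤ u
  1≤u = m^n>0 r {{>-nonZero (*-mono-≤ {1} {1 + i} (s≤s z≤n) 1≤t)}} (suc i)

  t≤b : t ≤ b
  t≤b = ≤-trans (m≤n*m t M) (m≤n+m (M * t) r)

  4≤b : 4 ≤ b
  4≤b = ≤-trans (m≤n+m 4 N) t≤b

  N≤b : N ≤ b
  N≤b = ≤-trans (m≤m+n N 4) t≤b

  c : ℕ
  c = u * u * (1 + A)

  M²≤u²b : M * M ≤ u * u * b
  M²≤u²b = ≤-trans (M²≤4u² u 1≤u) (*-monoʳ-≤ (u * u) 4≤b)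
    where M²≤4u² : ∀ u → 1 ≤ u → (1 + u) * (1 + u) ≤ u * u * 4
          M²≤4u² (suc v) _ = +-witness⇒≤ (identity v)
            where identity : ∀ v → (1 + suc v) * (1 + suc v) + (4 * v + 3 * (v * v)) ≡ suc v * suc v * 4
                  identity = solve-∀

  solution : RepdigitSolution 2 2 (suc i) b
  solution = record
    { y = u * M * (1 + A)
    ; c = c
    ; 2≤b = ≤-trans (m≤m+n 2 2) 4≤b
    ; 1≤y = *-mono-≤ (*-mono-≤ 1≤u (m≤m+n 1 u)) (m≤m+n 1 A)
    ; leading = *-cancelʳ-≤ (b ^ i) c (M * M) (begin
        b ^ i * (M * M)                ≤⟨ *-monoʳ-≤ (b ^ i) M²≤u²b ⟩
        b ^ i * (u * u * b)            ≡⟨ rotate (b ^ i) (u * u) b ⟩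
        u * u * b ^ suc i              ≤⟨ *-monoʳ-≤ (u * u) (m≤m+n (b ^ suc i) 1) ⟩
        u * u * (b ^ suc i + 1)        ≡⟨ cong (u * u *_) bⁱ⁺¹+1≡M²[1+A] ⟩
        u * u * (M * M * (1 + A))      ≡⟨ rearrange u M A ⟩
        c * (M * M)                    ∎)
    ; c<bˡ = +-cancelʳ-≤ 1 (suc c) (b ^ suc i) (begin
        suc c + 1                      ≡⟨ +-comm (suc c) 1 ⟩
        2 + c                          ≡⟨ +-comm 2 c ⟩
        c + 2                          ≤⟨ +-monoʳ-≤ c (≤-trans (m≤m+n 2 1) 3≤[2u+1][1+A]) ⟩
        c + (2 * u + 1) * (1 + A)      ≡⟨ expand u A ⟨
        M * M * (1 + A)                ≡⟨ bⁱ⁺¹+1≡M²[1+A] ⟨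
        b ^ suc i + 1                  ∎)
    ; equation = begin-equality
        (u * M * (1 + A)) ^ 2                      ≡⟨ ^-2 (u * M * (1 + A)) ⟩
        u * M * (1 + A) * (u * M * (1 + A))        ≡⟨ regroup u M A ⟩
        c * (M * M * (1 + A))                      ≡⟨ cong (c *_) bⁱ⁺¹+1≡M²[1+A] ⟨
        c * (b ^ suc i + 1)                        ≡⟨ cong (c *_) (repunit-2 (b ^ suc i)) ⟨
        c * repunit (b ^ suc i) 2                  ∎
    }
    where
    open ≤-Reasoning
    3≤[2u+1][1+A] : 3 ≤ (2 * u + 1) * (1 + A)
    3≤[2u+1][1+A] = *-mono-≤ (+-monoˡ-≤ 1 (*-monoʳ-≤ 2 1≤u)) (m≤m+n 1 A)
    rotate : ∀ x w z → x * (w * z) ≡ w * (z * x)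
    rotate = solve-∀
    rearrange : ∀ u M A → u * u * (M * M * (1 + A)) ≡ u * u * (1 + A) * (M * M)
    rearrange = solve-∀
    expand : ∀ u A → (1 + u) * (1 + u) * (1 + A) ≡ u * u * (1 + A) + (2 * u + 1) * (1 + A)
    expand = solve-∀
    regroup : ∀ u M A → u * M * (1 + A) * (u * M * (1 + A)) ≡ u * u * (1 + A) * (M * M * (1 + A))
    regroup = solve-∀

largeRepdigitPowers-2-2-ℓ : ∀ ℓ → 1 ≤ ℓ → ∀ N → LargeRepdigitPower 2 2 ℓ N
largeRepdigitPowers-2-2-ℓ (suc i) _ N =
  solution⇒large (s≤s z≤n) (s≤s z≤n) (SquareFamily.solution i N) (inj₁ (SquareFamily.N≤b i N))

largeRepdigitPowers-q-2-1 : ∀ q → 2 ≤ q → ∀ N → LargeRepdigitPower q 2 1 N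
largeRepdigitPowers-q-2-1 (suc p) (s≤s 1≤p) N =
  solution⇒large (s≤s z≤n) (s≤s z≤n) (solution-q-2-1 p 1≤p (m≤n+m 2 N))
    (inj₂ (≤-trans (m≤m+n N 2) (m≤n*m (N + 2) 2)))

admissible⇒largeRepdigitPowers : (q n ℓ : ℕ) → 2 ≤ q → 2 ≤ n → 1 ≤ ℓ → Admissible q n ℓ →
                                 ∀ N → LargeRepdigitPower q n ℓ N
admissible⇒largeRepdigitPowers _ _ ℓ _ _ 1≤ℓ (inj₁ (refl , refl)) = largeRepdigitPowers-2-2-ℓ ℓ 1≤ℓ
admissible⇒largeRepdigitPowers q _ _ 2≤q _ _ (inj₂ (inj₁ (refl , refl))) = largeRepdigitPowers-q-2-1 q 2≤q
admissible⇒largeRepdigitPowers _ _ _ _ _ _ (inj₂ (inj₂ (inj₁ (refl , refl , refl)))) =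
  orbit⇒large Orbit-b²+b+1=3t².orbit (s≤s z≤n) (s≤s z≤n) λ {(m , t)} → solution-2-3-1 {m} {t}
admissible⇒largeRepdigitPowers _ _ _ _ _ _ (inj₂ (inj₂ (inj₂ (inj₁ (refl , refl , refl))))) =
  orbit⇒large Orbit-b²+b+1=3t².orbit (s≤s z≤n) (s≤s z≤n) λ {(m , t)} → solution-2-3-2 {m} {t}
admissible⇒largeRepdigitPowers _ _ _ _ _ _ (inj₂ (inj₂ (inj₂ (inj₂ (inj₁ (refl , refl , refl)))))) =
  orbit⇒large Orbit-x²+1=2v².orbit (s≤s z≤n) (s≤s z≤n)
    λ {(k , v)} → Orbit-x²+1=2v².solution-3-2-2 {k} {v}
admissible⇒largeRepdigitPowers _ _ _ _ _ _ (inj₂ (inj₂ (inj₂ (inj₂ (inj₂ (inj₁ (refl , refl , refl))))))) =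
  orbit⇒large Orbit-b²-b+1=3w².orbit (s≤s z≤n) (s≤s z≤n)
    λ {(m , w)} → Orbit-b²-b+1=3w².solution-3-2-3 {m} {w}
admissible⇒largeRepdigitPowers _ _ _ _ _ _ (inj₂ (inj₂ (inj₂ (inj₂ (inj₂ (inj₂ (inj₁ (refl , refl , refl)))))))) =
  orbit⇒large Orbit-b²+b+1=343W².orbit (s≤s z≤n) (s≤s z≤n) λ {(m , W)} → solution-3-3-1 {m} {W}
admissible⇒largeRepdigitPowers _ _ _ _ _ _ (inj₂ (inj₂ (inj₂ (inj₂ (inj₂ (inj₂ (inj₂ (inj₁ (refl , refl , refl))))))))) =
  orbit⇒large Orbit-x²+1=2v².orbit (s≤s z≤n) (s≤s z≤n)
    λ {(k , v)} → Orbit-x²+1=2v².solution-2-4-1 {k} {v}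
admissible⇒largeRepdigitPowers _ _ _ _ _ _ (inj₂ (inj₂ (inj₂ (inj₂ (inj₂ (inj₂ (inj₂ (inj₂ (refl , refl , refl))))))))) =
  orbit⇒large Orbit-b²+1=125v².orbit (s≤s z≤n) (s≤s z≤n)
    λ {(b , v)} → Orbit-b²+1=125v².solution-4-2-2 {b} {v}

mainTheorem1 : (ABC →
    ∃[ L ] ((q n ℓ b y c : ℕ) → 2 ≤ q → 2 ≤ n → 1 ≤ ℓ → 2 ≤ b → 1 ≤ y →
      b ^ (ℓ ∸ 1) ≤ c → c < b ^ ℓ → ¬ Admissible q n ℓ →
      y ^ q * (b ^ ℓ ∸ 1) ≡ c * (b ^ (n * ℓ) ∸ 1) →
      (q , n , ℓ , b , y , c) ∈ L))
    ×
    ((q n ℓ : ℕ) → 2 ≤ q → 2 ≤ n → 1 ≤ ℓ → Admissible q n ℓ →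
      (N : ℕ) → ∃[ b ] ∃[ y ] (2 ≤ b × 1 ≤ y × (N ≤ b ⊎ N ≤ y) ×
        ∃[ w ] (All (_< b) w × length w ≡ ℓ × rep b (y ^ q) ≡ w ↑ n)))
mainTheorem1 = inadmissibleRepdigitPowers-finite , admissible⇒largeRepdigitPowers
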